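{- Let $A$ be an $n\times n$ matrix. Let $3\le k\le n$, and suppose Dodgson's method applied to $A$ has produced $A^{(n)}=A,\dots,A^{(k)}$ without division by zero. Suppose the interior of $A^{(k)}$ contains a zero in row $i$ and column $j$ of $A^{(k)}$, where $2\le i,j\le k-1$. Suppose further that the element $\alpha=A^{(k)}_{i-1,j}$ is non-zero. Let $\ell=n-k$. Let $\mathcal{A}$ be the $(\ell+3)\times(\ell+3)$ submatrix of $A$ whose upper left corner is the entry in row $i-1$ and column $j-1$ of $A$, i.e. $\mathcal{A}=A_{i-1\ldots i+\ell+1,\;j-1\ldots j+\ell+1}$. Cross out from $\mathcal{A}$ the $(\ell+1)\times(\ell+1)$ submatrix occupying rows $1,\dots,\ell+1$ and columns $2,\dots,\ell+2$ of $\mathcal{A}$. This crossing out leaves the $2\times2$ complementary matrix $M^*$, occupying rows $\ell+2,\ell+3$ and columns $1,\ell+3$ of $\mathcal{A}$. Let $M'$ be the $2\times 2$ matrix whose entry in each position is the minor in $\mathcal{A}$ of the corresponding element of $M^*$. Here the minor of the element in row $p$ and column $q$ of $\mathcal{A}$ is the determinant of $\mathcal{A}$ with row $p$ and column $q$ deleted. Then the element in row $i-1$ and column $j-1$ of $A^{(k-2)}$ can be computed as $\det M'/\alpha$. That is, \[ \frac{\det M'}{\alpha}=\det\mathcal{A}=\det A_{i-1\ldots i+\ell+1,\;j-1\ldots j+\ell+1}, \] which is the value that entry has in a successful run of Dodgson's method.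
   Context: Notation: $A_{i\ldots j,\,k\ldots \ell}$ denotes the submatrix formed by rows $i,\dots,j$ and columns $k,\dots,\ell$ of $A$. The interior of an $m\times m$ matrix $X$ is the $(m-1)\times(m-1)$ matrix with $(p,q)$ entry $X_{p+1,q+1}$; an entry of $X$ is "in the interior" if it lies in rows $2,\dots,m-1$ and columns $2,\dots,m-1$. Dodgson's method for an $n\times n$ matrix $A$: set $A^{(n)}=A$. For $m=n-1,\dots,1$, let $B^{(m)}_{p,q}=A^{(m+1)}_{p,q}A^{(m+1)}_{p+1,q+1}-A^{(m+1)}_{p+1,q}A^{(m+1)}_{p,q+1}$ for $1\le p,q\le m$. Set $A^{(n-1)}=B^{(n-1)}$. For $m\le n-2$, set $A^{(m)}_{p,q}=B^{(m)}_{p,q}/A^{(m+2)}_{p+1,q+1}$. The method fails if one of these divisors is zero. When all steps succeed, $A^{(m)}_{p,q}=\det A_{p\ldots p+n-m,\;q\ldots q+n-m}$. In particular $A^{(k)}_{i-1,j}=\det A_{i-1\ldots i-1+\ell,\;j\ldots j+\ell}$ with $\ell=n-k$. -}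

module Defs where

open import Level using (Level; _⊔_) renaming (suc to lsuc)
open import Data.Nat using (ℕ; zero; suc; _<ᵇ_; _∸_) renaming (_+_ to _+ℕ_)
open import Data.Bool using (if_then_else_)
open import Relation.Nullary using (¬_)
open import Algebra.Bundles using (CommutativeRing)

-- A field: a commutative ring with 1 ≠ 0 and a total inverse operation
-- that is a genuine multiplicative inverse on every non-zero element
-- (the value of 0⁻¹ is irrelevant and never used meaningfully).
record Field (c ℓ : Level) : Set (lsuc (c ⊔ ℓ)) where
  field
    commutativeRing : CommutativeRing c ℓ
  open CommutativeRing commutativeRing public
  infix 8 _⁻¹
  field
    _⁻¹     : Carrier → Carrier
    1≉0     : ¬ (1# ≈ 0#)
    inverse : ∀ x → ¬ (x ≈ 0#) → x * (x ⁻¹) ≈ 1#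

  infixl 7 _/_
  _/_ : Carrier → Carrier → Carrier
  x / y = x * (y ⁻¹)

module MatrixDefs {c ℓ : Level} (F : Field c ℓ) where
  open Field F

  -- Matrices are indexed 1-based by natural numbers, as in the paper;
  -- an m×m matrix M only uses the entries M p q with 1 ≤ p,q ≤ m.
  Matrix : Set c
  Matrix = ℕ → ℕ → Carrier

  Σ[1…_] : ℕ → (ℕ → Carrier) → Carrier
  Σ[1… zero ] f = 0#
  Σ[1… suc m ] f = Σ[1… m ] f + f (suc m)

  sign : ℕ → Carrier
  sign zero = 1#
  sign (suc k) = - sign k

  minorMatrix : Matrix → ℕ → ℕ → Matrix
  minorMatrix M p q r s =
    M (if r <ᵇ p then r else suc r) (if s <ᵇ q then s else suc s)

  det : ℕ → Matrix → Carrier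
  det zero M = 1#
  det (suc m) M =
    Σ[1… suc m ] (λ q → sign (q ∸ 1) * M 1 q * det m (minorMatrix M 1 q))

  -- the submatrix whose upper-left corner is entry (i , j)
  -- (size is implicit: A_{i…i+s, j…j+s} is  sub A i j  viewed as (s+1)×(s+1))
  sub : Matrix → ℕ → ℕ → Matrix
  sub A i j p q = A (i ∸ 1 +ℕ p) (j ∸ 1 +ℕ q)

  cond : Matrix → Matrix
  cond X p q = X p q * X (suc p) (suc q) - X (suc p) q * X p (suc q)

  -- Dodgson's method: dodgson A t is A^{(n-t)} (t steps of condensation).
  -- A^{(n)} = A, A^{(n-1)} = B^{(n-1)},
  -- A^{(m)}_{p,q} = B^{(m)}_{p,q} / A^{(m+2)}_{p+1,q+1}.
  dodgson : Matrix → ℕ → Matrix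
  dodgson A zero = A
  dodgson A (suc zero) = cond A
  dodgson A (suc (suc t)) p q =
    cond (dodgson A (suc t)) p q / dodgson A t (suc p) (suc q)

  level : ℕ → Matrix → ℕ → Matrix
  level n A m = dodgson A (n ∸ m)

  -- Dodgson's method has produced A^{(n)},…,A^{(k)} without division by
  -- zero: every divisor A^{(m+2)}_{p+1,q+1} used to form A^{(m)}, for
  -- k ≤ m ≤ n-2 and 1 ≤ p,q ≤ m, is non-zero.
  NoZeroDivisorDownTo : ℕ → Matrix → ℕ → Set ℓ
  NoZeroDivisorDownTo n A k =
    ∀ m p q → k Data.Nat.≤ m → suc (suc m) Data.Nat.≤ n →
      1 Data.Nat.≤ p → p Data.Nat.≤ m → 1 Data.Nat.≤ q → q Data.Nat.≤ m →
      ¬ (level n A (suc (suc m)) (suc p) (suc q) ≈ 0#)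

  det2 : Carrier → Carrier → Carrier → Carrier → Carrier
  det2 a b c' d = a * d - b * c'

-- Dodgson's method, as long as it never divides by zero, produces connected minors: A^{(m)}_{p,q} is the
-- determinant of the (n-m+1)-square block of A with upper left corner (p, q). This follows by induction on the
-- number of steps, each step being the Desnanot–Jacobi identity for that block. Hence α = A^{(k)}_{i-1,j} is
-- the minor of 𝒜 on its rows 1…ℓ+1 and columns 2…ℓ+2, and the Desnanot–Jacobi identity for 𝒜, taken with
-- the rows ℓ+2, ℓ+3 and the columns 1, ℓ+3, reads det 𝒜 · α = det M'.

module Submission where

open import Defs
open import Level using (Level)
open import Data.Nat as ℕ using (ℕ; zero; suc; _≤_; _<_; _∸_; z≤n; s≤s; _<ᵇ_; _≡ᵇ_; _≟_; _<?_)
import Data.Nat.Properties as ℕₚ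
open import Data.Nat.Tactic.RingSolver using (solve-∀)
open import Data.Bool using (true; false; if_then_else_)
open import Data.Empty using (⊥-elim)
open import Data.Product using (_×_; _,_; proj₁; proj₂)
open import Data.Sum using (_⊎_; inj₁; inj₂)
open import Relation.Binary.Definitions using (tri<; tri≈; tri>)
open import Relation.Binary.PropositionalEquality as ≡ using (_≡_; _≢_)
open import Relation.Nullary using (¬_; yes; no)
import Algebra.Properties.Ring as RingProperties
import Algebra.Solver.Ring.NaturalCoefficients.Default as NaturalSolver
import Relation.Binary.Reasoning.Setoid as SetoidReasoning

<ᵇ-true : ∀ {r p} → r < p → (r <ᵇ p) ≡ true
<ᵇ-true {zero} {suc p} _ = ≡.refl
<ᵇ-true {suc r} {suc p} (s≤s r<p) = <ᵇ-true r<p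

<ᵇ-false : ∀ {r p} → p ≤ r → (r <ᵇ p) ≡ false
<ᵇ-false {r} {zero} _ = ≡.refl
<ᵇ-false {suc r} {suc p} (s≤s p≤r) = <ᵇ-false p≤r

≡ᵇ-refl : ∀ n → (n ≡ᵇ n) ≡ true
≡ᵇ-refl zero = ≡.refl
≡ᵇ-refl (suc n) = ≡ᵇ-refl n

≡ᵇ-false : ∀ {m n} → m ≢ n → (m ≡ᵇ n) ≡ false
≡ᵇ-false {zero} {zero} m≢n = ⊥-elim (m≢n ≡.refl)
≡ᵇ-false {zero} {suc n} _ = ≡.refl
≡ᵇ-false {suc m} {zero} _ = ≡.refl
≡ᵇ-false {suc m} {suc n} m≢n = ≡ᵇ-false (λ e → m≢n (≡.cong suc e))

-- Row (column) r of  minorMatrix M p _  is row punchIn p r of M; this is Data.Fin.punchIn on ℕ.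
punchIn : ℕ → ℕ → ℕ
punchIn p r = if r <ᵇ p then r else suc r

punchIn-< : ∀ {p r} → r < p → punchIn p r ≡ r
punchIn-< r<p rewrite <ᵇ-true r<p = ≡.refl

punchIn-≥ : ∀ {p r} → p ≤ r → punchIn p r ≡ suc r
punchIn-≥ p≤r rewrite <ᵇ-false p≤r = ≡.refl

punchIn-suc : ∀ p r → punchIn (suc p) (suc r) ≡ suc (punchIn p r)
punchIn-suc p r with r <ᵇ p
... | true = ≡.refl
... | false = ≡.refl

punchIn-≤suc : ∀ p r → punchIn p r ≤ suc r
punchIn-≤suc p r with r <ᵇ p
... | true = ℕₚ.n≤1+n r
... | false = ℕₚ.≤-refl

≤-punchIn : ∀ p r → r ≤ punchIn p r
≤-punchIn p r with r <ᵇ p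
... | true = ℕₚ.≤-refl
... | false = ℕₚ.n≤1+n r

punchInᵢ≢i : ∀ p r → punchIn p r ≢ p
punchInᵢ≢i p r with ℕₚ.<-cmp r p
... | tri< r<p _ _ rewrite punchIn-< r<p = ℕₚ.<⇒≢ r<p
... | tri≈ _ ≡.refl _ rewrite punchIn-≥ (ℕₚ.≤-refl {r}) = ℕₚ.1+n≢n
... | tri> _ _ p<r rewrite punchIn-≥ (ℕₚ.<⇒≤ p<r) = ≡.≢-sym (ℕₚ.<⇒≢ (ℕₚ.m<n⇒m<1+n p<r))

punchIn-separates : ∀ {p r s} → r < p → p ≤ s → punchIn p r ≢ punchIn p s
punchIn-separates {p} {r} {s} r<p p≤s e = ℕₚ.<-irrefl r≡1+s (ℕₚ.<-≤-trans r<p (ℕₚ.m≤n⇒m≤1+n p≤s))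
  where r≡1+s = ≡.trans (≡.sym (punchIn-< r<p)) (≡.trans e (punchIn-≥ p≤s))

punchIn-injective : ∀ p {r s} → punchIn p r ≡ punchIn p s → r ≡ s
punchIn-injective p {r} {s} e with r <? p | s <? p
... | yes r<p | yes s<p = ≡.trans (≡.sym (punchIn-< r<p)) (≡.trans e (punchIn-< s<p))
... | no r≮p | no s≮p =
  ℕₚ.suc-injective (≡.trans (≡.sym (punchIn-≥ (ℕₚ.≮⇒≥ r≮p))) (≡.trans e (punchIn-≥ (ℕₚ.≮⇒≥ s≮p))))
... | yes r<p | no s≮p = ⊥-elim (punchIn-separates r<p (ℕₚ.≮⇒≥ s≮p) e)
... | no r≮p | yes s<p = ⊥-elim (punchIn-separates s<p (ℕₚ.≮⇒≥ r≮p) (≡.sym e))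

punchIn-punchIn : ∀ {p q} r → p ≤ q → punchIn (suc q) (punchIn p r) ≡ punchIn p (punchIn q r)
punchIn-punchIn {p} {q} r p≤q with r <? p | r <? q
... | yes r<p | _ rewrite punchIn-< r<p | punchIn-< (ℕₚ.<-≤-trans r<p p≤q)
                        | punchIn-< {suc q} (ℕₚ.m<n⇒m<1+n (ℕₚ.<-≤-trans r<p p≤q)) | punchIn-< r<p = ≡.refl
... | no r≮p | yes r<q rewrite punchIn-≥ (ℕₚ.≮⇒≥ r≮p) | punchIn-< r<q
                             | punchIn-< {suc q} (s≤s r<q) | punchIn-≥ (ℕₚ.≮⇒≥ r≮p) = ≡.refl
... | no r≮p | no r≮q rewrite punchIn-≥ (ℕₚ.≮⇒≥ r≮p) | punchIn-≥ (ℕₚ.≮⇒≥ r≮q)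
                             | punchIn-≥ {suc q} (s≤s (ℕₚ.≮⇒≥ r≮q))
                             | punchIn-≥ {p} {suc r} (ℕₚ.m≤n⇒m≤1+n (ℕₚ.≮⇒≥ r≮p)) = ≡.refl

punchIn-adjacent : ∀ c r → punchIn c r ≡ punchIn (suc c) r
                          ⊎ (punchIn c r ≡ suc c × punchIn (suc c) r ≡ c)
punchIn-adjacent c r with ℕₚ.<-cmp r c
... | tri< r<c _ _ = inj₁ (≡.trans (punchIn-< r<c) (≡.sym (punchIn-< (ℕₚ.m<n⇒m<1+n r<c))))
... | tri≈ _ ≡.refl _ = inj₂ (punchIn-≥ ℕₚ.≤-refl , punchIn-< (ℕₚ.n<1+n r))
... | tri> _ _ c<r = inj₁ (≡.trans (punchIn-≥ (ℕₚ.<⇒≤ c<r)) (≡.sym (punchIn-≥ c<r)))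

punchIn²≢ : ∀ c r → punchIn (suc c) (punchIn c r) ≢ c
punchIn²≢ c r e with punchIn c r <? suc c
... | yes s<1+c = punchInᵢ≢i c r (≡.trans (≡.sym (punchIn-< s<1+c)) e)
... | no s≮1+c = ℕₚ.<-irrefl (≡.trans (≡.sym e) (punchIn-≥ (ℕₚ.≮⇒≥ s≮1+c))) (ℕₚ.m≤n⇒m≤1+n (ℕₚ.≮⇒≥ s≮1+c))

-- Deleting column q ∉ {c, c+1} keeps the columns c, c+1 adjacent: they become c', c'+1.
record AdjacentPreimage (q c m : ℕ) : Set where
  field
    c'    : ℕ
    1≤c'  : 1 ≤ c'
    c'<m  : suc c' ≤ m
    image : punchIn q c' ≡ c
    image-suc : punchIn q (suc c') ≡ suc c

adjacentPreimage : ∀ {q c m} → 1 ≤ q → q ≤ suc m → 1 ≤ c → suc c ≤ suc m →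
                   q ≢ c → q ≢ suc c → AdjacentPreimage q c m
adjacentPreimage {q} {c} 1≤q q≤1+m 1≤c c<1+m q≢c q≢1+c with ℕₚ.<-cmp q c
... | tri≈ _ q≡c _ = ⊥-elim (q≢c q≡c)
... | tri< q<c _ _ with c | q<c
...   | suc c₀ | s≤s q≤c₀ = record
  { c' = c₀ ; 1≤c' = ℕₚ.≤-trans 1≤q q≤c₀ ; c'<m = ℕₚ.≤-pred c<1+m
  ; image = punchIn-≥ q≤c₀ ; image-suc = punchIn-≥ (ℕₚ.m≤n⇒m≤1+n q≤c₀) }
adjacentPreimage {q} {c} 1≤q q≤1+m 1≤c c<1+m q≢c q≢1+c | tri> _ _ c<q with ℕₚ.m≤n⇒m<n∨m≡n c<q
... | inj₂ 1+c≡q = ⊥-elim (q≢1+c (≡.sym 1+c≡q))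
... | inj₁ 1+c<q = record
  { c' = c ; 1≤c' = 1≤c ; c'<m = ℕₚ.≤-pred (ℕₚ.<-≤-trans 1+c<q q≤1+m)
  ; image = punchIn-< c<q ; image-suc = punchIn-< 1+c<q }

swapAdjacent : ℕ → ℕ → ℕ
swapAdjacent c r = if r ≡ᵇ c then suc c else (if r ≡ᵇ suc c then c else r)

swapAdjacent-c : ∀ c → swapAdjacent c c ≡ suc c
swapAdjacent-c c rewrite ≡ᵇ-refl c = ≡.refl

swapAdjacent-suc : ∀ c → swapAdjacent c (suc c) ≡ c
swapAdjacent-suc c rewrite ≡ᵇ-false {suc c} {c} ℕₚ.1+n≢n | ≡ᵇ-refl c = ≡.refl

swapAdjacent-other : ∀ c r → r ≢ c → r ≢ suc c → swapAdjacent c r ≡ r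
swapAdjacent-other c r r≢c r≢1+c rewrite ≡ᵇ-false r≢c | ≡ᵇ-false r≢1+c = ≡.refl

swapAdjacent-punchIn : ∀ q {c c'} → punchIn q c' ≡ c → punchIn q (suc c') ≡ suc c →
                       ∀ r → swapAdjacent c (punchIn q r) ≡ punchIn q (swapAdjacent c' r)
swapAdjacent-punchIn q {c} {c'} e e-suc r with r ≟ c' | r ≟ suc c'
... | yes ≡.refl | _ rewrite swapAdjacent-c r | e | swapAdjacent-c c = ≡.sym e-suc
... | no _ | yes ≡.refl rewrite swapAdjacent-suc c' | e-suc | swapAdjacent-suc c = ≡.sym e
... | no r≢c' | no r≢1+c' rewrite swapAdjacent-other c' r r≢c' r≢1+c' =
  swapAdjacent-other c (punchIn q r) (λ e' → r≢c' (punchIn-injective q (≡.trans e' (≡.sym e))))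
                                     (λ e' → r≢1+c' (punchIn-injective q (≡.trans e' (≡.sym e-suc))))

swapAdjacent-punchIn-c : ∀ c r → swapAdjacent c (punchIn c r) ≡ punchIn (suc c) r
swapAdjacent-punchIn-c c r with punchIn-adjacent c r
... | inj₁ e = ≡.trans (swapAdjacent-other c _ (punchInᵢ≢i c r)
                 (λ e' → punchInᵢ≢i (suc c) r (≡.trans (≡.sym e) e'))) e
... | inj₂ (e , e-suc) rewrite e | e-suc = swapAdjacent-suc c

swapAdjacent-punchIn-suc : ∀ c r → swapAdjacent c (punchIn (suc c) r) ≡ punchIn c r
swapAdjacent-punchIn-suc c r with punchIn-adjacent c r
... | inj₁ e = ≡.trans (swapAdjacent-other c _ (λ e' → punchInᵢ≢i c r (≡.trans e e'))
                 (punchInᵢ≢i (suc c) r)) (≡.sym e)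
... | inj₂ (e , e-suc) rewrite e | e-suc = swapAdjacent-c c

module Determinants {a ℓ : Level} (F : Field a ℓ) where
  open Field F hiding (zero)
  open MatrixDefs F
  open RingProperties ring
    using (-‿involutive; -0#≈0#; -‿+-comm; -‿distribˡ-*; -‿distribʳ-*; +-inverseˡ-unique; x+x≈x⇒x≈0)
  open NaturalSolver commutativeSemiring using (solve; _:+_; _:*_; _:=_)
  open SetoidReasoning setoid

  -‿pullˡ : ∀ a b d → - a * b * d ≈ - (a * b * d)
  -‿pullˡ a b d = trans (*-congʳ (sym (-‿distribˡ-* a b))) (sym (-‿distribˡ-* (a * b) d))

  -‿cancel : ∀ x y → - x * - y ≈ x * y
  -‿cancel x y = trans (sym (-‿distribˡ-* x (- y))) (trans (-‿cong (sym (-‿distribʳ-* x y))) (-‿involutive _))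

  sign-+2 : ∀ k → sign (suc (suc k)) ≈ sign k
  sign-+2 k = -‿involutive (sign k)

  sign-+ : ∀ a b → sign (a ℕ.+ b) ≈ sign a * sign b
  sign-+ zero b = sym (*-identityˡ _)
  sign-+ (suc a) b = trans (-‿cong (sign-+ a b)) (-‿distribˡ-* _ _)

  sign-squared : ∀ k → sign k * sign k ≈ 1#
  sign-squared zero = *-identityˡ _
  sign-squared (suc k) = trans (-‿cancel (sign k) (sign k)) (sign-squared k)

  *-cancelʳ-nonzero : ∀ {x y k} → ¬ (k ≈ 0#) → x * k ≈ y * k → x ≈ y
  *-cancelʳ-nonzero {x} {y} {k} k≉0 xk≈yk = begin
    x                ≈⟨ *-identityʳ x ⟨
    x * 1#           ≈⟨ *-congˡ (inverse k k≉0) ⟨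
    x * (k * k ⁻¹)   ≈⟨ *-assoc _ _ _ ⟨
    x * k * k ⁻¹     ≈⟨ *-congʳ xk≈yk ⟩
    y * k * k ⁻¹     ≈⟨ *-assoc _ _ _ ⟩
    y * (k * k ⁻¹)   ≈⟨ *-congˡ (inverse k k≉0) ⟩
    y * 1#           ≈⟨ *-identityʳ y ⟩
    y                ∎

  *-cancelˡ-selfInverse : ∀ {s x y} → s * s ≈ 1# → s * x ≈ s * y → x ≈ y
  *-cancelˡ-selfInverse {s} {x} {y} ss≈1 sx≈sy = begin
    x              ≈⟨ *-identityˡ x ⟨
    1# * x         ≈⟨ *-congʳ ss≈1 ⟨
    s * s * x      ≈⟨ *-assoc _ _ _ ⟩
    s * (s * x)    ≈⟨ *-congˡ sx≈sy ⟩
    s * (s * y)    ≈⟨ *-assoc _ _ _ ⟨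
    s * s * y      ≈⟨ *-congʳ ss≈1 ⟩
    1# * y         ≈⟨ *-identityˡ y ⟩
    y              ∎

  *≈⇒/≈ : ∀ {d k x} → ¬ (k ≈ 0#) → d * k ≈ x → x / k ≈ d
  *≈⇒/≈ {d} {k} {x} k≉0 dk≈x = begin
    x * k ⁻¹         ≈⟨ *-congʳ dk≈x ⟨
    d * k * k ⁻¹     ≈⟨ *-assoc _ _ _ ⟩
    d * (k * k ⁻¹)   ≈⟨ *-congˡ (inverse k k≉0) ⟩
    d * 1#           ≈⟨ *-identityʳ d ⟩
    d                ∎

  -- Finite sums

  Σ-cong : ∀ n {f g : ℕ → Carrier} → (∀ q → q < n → f (suc q) ≈ g (suc q)) → Σ[1… n ] f ≈ Σ[1… n ] g
  Σ-cong zero _ = refl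
  Σ-cong (suc n) f≈g = +-cong (Σ-cong n (λ q q<n → f≈g q (ℕₚ.m<n⇒m<1+n q<n))) (f≈g n (ℕₚ.n<1+n n))

  Σ-zero : ∀ n (f : ℕ → Carrier) → (∀ q → q < n → f (suc q) ≈ 0#) → Σ[1… n ] f ≈ 0#
  Σ-zero n f f≈0 = trans (Σ-cong n f≈0) (Σ-const n)
    where
    Σ-const : ∀ n → Σ[1… n ] (λ _ → 0#) ≈ 0#
    Σ-const zero = refl
    Σ-const (suc n) = trans (+-identityʳ _) (Σ-const n)

  Σ-+ : ∀ n (f g : ℕ → Carrier) → Σ[1… n ] (λ q → f q + g q) ≈ Σ[1… n ] f + Σ[1… n ] g
  Σ-+ zero f g = sym (+-identityˡ _)
  Σ-+ (suc n) f g = trans (+-congʳ (Σ-+ n f g))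
    (solve 4 (λ a b u v → (a :+ b) :+ (u :+ v) := (a :+ u) :+ (b :+ v)) refl _ _ _ _)

  *-Σ : ∀ n a (f : ℕ → Carrier) → a * Σ[1… n ] f ≈ Σ[1… n ] (λ q → a * f q)
  *-Σ zero a f = zeroʳ a
  *-Σ (suc n) a f = trans (distribˡ _ _ _) (+-congʳ (*-Σ n a f))

  -‿Σ : ∀ n (f : ℕ → Carrier) → - Σ[1… n ] f ≈ Σ[1… n ] (λ q → - f q)
  -‿Σ zero f = -0#≈0#
  -‿Σ (suc n) f = trans (sym (-‿+-comm _ _)) (+-congʳ (-‿Σ n f))

  Σ-head : ∀ n (f : ℕ → Carrier) → Σ[1… suc n ] f ≈ f 1 + Σ[1… n ] (λ q → f (suc q))
  Σ-head zero f = trans (+-identityˡ _) (sym (+-identityʳ _))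
  Σ-head (suc n) f = trans (+-congʳ (Σ-head n f)) (+-assoc _ _ _)

  Σ-comm : ∀ n m (f : ℕ → ℕ → Carrier) →
           Σ[1… n ] (λ q → Σ[1… m ] (f q)) ≈ Σ[1… m ] (λ r → Σ[1… n ] (λ q → f q r))
  Σ-comm zero m f = sym (Σ-zero m _ (λ _ _ → refl))
  Σ-comm (suc n) m f = trans (+-congʳ (Σ-comm n m f)) (sym (Σ-+ m _ _))

  Σ-extract : ∀ n (f : ℕ → Carrier) c → 1 ≤ c → c ≤ suc n →
              Σ[1… suc n ] f ≈ Σ[1… n ] (λ q → f (punchIn c q)) + f c
  Σ-extract zero f c 1≤c c≤1 with ℕₚ.≤-antisym c≤1 1≤c
  ... | ≡.refl = refl
  Σ-extract (suc n) f c 1≤c c≤2+n with ℕₚ.m≤n⇒m<n∨m≡n c≤2+n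
  ... | inj₂ ≡.refl = +-congʳ (Σ-cong (suc n) (λ q q<1+n → reflexive (≡.cong f (≡.sym (punchIn-< (s≤s q<1+n))))))
  ... | inj₁ (s≤s c≤1+n) = begin
    Σ[1… suc n ] f + f (suc (suc n))
      ≈⟨ +-congʳ (Σ-extract n f c 1≤c c≤1+n) ⟩
    (Σ[1… n ] (λ q → f (punchIn c q)) + f c) + f (suc (suc n))
      ≈⟨ solve 3 (λ a b d → (a :+ b) :+ d := (a :+ d) :+ b) refl _ _ _ ⟩
    (Σ[1… n ] (λ q → f (punchIn c q)) + f (suc (suc n))) + f c
      ≡⟨ ≡.cong (λ r → (Σ[1… n ] (λ q → f (punchIn c q)) + f r) + f c) (≡.sym (punchIn-≥ c≤1+n)) ⟩
    (Σ[1… n ] (λ q → f (punchIn c q)) + f (punchIn c (suc n))) + f c ∎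

  Σ-single : ∀ n (f : ℕ → Carrier) k → 1 ≤ k → k ≤ n →
             (∀ q → 1 ≤ q → q ≤ n → q ≢ k → f q ≈ 0#) → Σ[1… n ] f ≈ f k
  Σ-single zero f zero () _ _
  Σ-single (suc n) f k 1≤k k≤1+n f≈0 = begin
    Σ[1… suc n ] f                           ≈⟨ Σ-extract n f k 1≤k k≤1+n ⟩
    Σ[1… n ] (λ q → f (punchIn k q)) + f k   ≈⟨ +-congʳ (Σ-zero n _ off-k) ⟩
    0# + f k                                 ≈⟨ +-identityˡ _ ⟩
    f k                                      ∎
    where
    off-k : ∀ q → q < n → f (punchIn k (suc q)) ≈ 0#
    off-k q q<n = f≈0 _ (ℕₚ.≤-trans (s≤s z≤n) (≤-punchIn k (suc q)))
                        (ℕₚ.≤-trans (punchIn-≤suc k (suc q)) (s≤s q<n)) (punchInᵢ≢i k (suc q))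

  -- Laplace expansion, transposition and alternation

  laplaceTerm : ℕ → Matrix → ℕ → Carrier
  laplaceTerm m M q = sign (q ∸ 1) * M 1 q * det m (minorMatrix M 1 q)

  AgreeOn : ℕ → Matrix → Matrix → Set ℓ
  AgreeOn m M N = ∀ a b → a < m → b < m → M (suc a) (suc b) ≈ N (suc a) (suc b)

  -- Rows are numbered from 0 here: the rows of M and N other than row r + 1 agree.
  AgreeOffRow : ℕ → Matrix → Matrix → Set ℓ
  AgreeOffRow r M N = ∀ a b → a ≢ r → M (suc a) (suc b) ≈ N (suc a) (suc b)

  minor₁ : ∀ (M : Matrix) q a b → minorMatrix M 1 (suc q) (suc a) (suc b) ≡ M (suc (suc a)) (suc (punchIn q b))
  minor₁ M q a b = ≡.cong (M (suc (suc a))) (punchIn-suc q b)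

  det-cong : ∀ m (M N : Matrix) → AgreeOn m M N → det m M ≈ det m N
  det-cong zero _ _ _ = refl
  det-cong (suc m) M N M≈N = Σ-cong (suc m) (λ q q<1+m →
    *-cong (*-congˡ (M≈N 0 q (s≤s z≤n) q<1+m)) (det-cong m _ _ (λ a b a<m b<m → begin
      minorMatrix M 1 (suc q) (suc a) (suc b)  ≡⟨ minor₁ M q a b ⟩
      M (suc (suc a)) (suc (punchIn q b))      ≈⟨ M≈N (suc a) (punchIn q b) (s≤s a<m)
                                                    (s≤s (ℕₚ.≤-trans (punchIn-≤suc q b) b<m)) ⟩
      N (suc (suc a)) (suc (punchIn q b))      ≡⟨ minor₁ N q a b ⟨
      minorMatrix N 1 (suc q) (suc a) (suc b)  ∎)))

  det-1×1 : ∀ (X : Matrix) → det 1 X ≈ X 1 1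
  det-1×1 X = trans (+-identityˡ _) (trans (*-identityʳ _) (*-identityˡ _))

  det-2×2 : ∀ (X : Matrix) → det 2 X ≈ X 1 1 * X 2 2 - X 1 2 * X 2 1
  det-2×2 X = +-cong (trans (+-identityˡ _) (*-cong (*-identityˡ _) (det-1×1 (minorMatrix X 1 1))))
                     (trans (-‿pullˡ _ _ _) (-‿cong (*-cong (*-identityˡ _) (det-1×1 (minorMatrix X 1 2)))))

  AgreeOffRow-minor₁ : ∀ {r} M N q → AgreeOffRow (suc r) M N →
                       AgreeOffRow r (minorMatrix M 1 (suc q)) (minorMatrix N 1 (suc q))
  AgreeOffRow-minor₁ M N q M≈N a b a≢r = begin
    minorMatrix M 1 (suc q) (suc a) (suc b)  ≡⟨ minor₁ M q a b ⟩
    M (suc (suc a)) (suc (punchIn q b))      ≈⟨ M≈N (suc a) (punchIn q b) (λ e → a≢r (ℕₚ.suc-injective e)) ⟩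
    N (suc (suc a)) (suc (punchIn q b))      ≡⟨ minor₁ N q a b ⟨
    minorMatrix N 1 (suc q) (suc a) (suc b)  ∎

  AgreeOffRow₀-minor₁ : ∀ {m} M N q → AgreeOffRow 0 M N → AgreeOn m (minorMatrix M 1 (suc q)) (minorMatrix N 1 (suc q))
  AgreeOffRow₀-minor₁ M N q M≈N a b _ _ = begin
    minorMatrix M 1 (suc q) (suc a) (suc b)  ≡⟨ minor₁ M q a b ⟩
    M (suc (suc a)) (suc (punchIn q b))      ≈⟨ M≈N (suc a) (punchIn q b) (λ ()) ⟩
    N (suc (suc a)) (suc (punchIn q b))      ≡⟨ minor₁ N q a b ⟨
    minorMatrix N 1 (suc q) (suc a) (suc b)  ∎

  det-linear-termwise : ∀ m (X Y Z : Matrix) α →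
    (∀ q → laplaceTerm m X (suc q) ≈ α * laplaceTerm m Y (suc q) + laplaceTerm m Z (suc q)) →
    det (suc m) X ≈ α * det (suc m) Y + det (suc m) Z
  det-linear-termwise m X Y Z α termwise = begin
    det (suc m) X
      ≈⟨ Σ-cong (suc m) (λ q _ → termwise q) ⟩
    Σ[1… suc m ] (λ q → α * laplaceTerm m Y q + laplaceTerm m Z q)
      ≈⟨ Σ-+ (suc m) _ _ ⟩
    Σ[1… suc m ] (λ q → α * laplaceTerm m Y q) + det (suc m) Z
      ≈⟨ +-congʳ (*-Σ (suc m) α _) ⟨
    α * det (suc m) Y + det (suc m) Z ∎

  det-rowLinear : ∀ m (X Y Z : Matrix) r α → r < m → AgreeOffRow r X Y → AgreeOffRow r X Z →
    (∀ b → X (suc r) (suc b) ≈ α * Y (suc r) (suc b) + Z (suc r) (suc b)) →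
    det m X ≈ α * det m Y + det m Z
  det-rowLinear (suc m) X Y Z zero α _ X≈Y X≈Z Xᵣ = det-linear-termwise m X Y Z α termwise
    where
    termwise : ∀ q → laplaceTerm m X (suc q) ≈ α * laplaceTerm m Y (suc q) + laplaceTerm m Z (suc q)
    termwise q = begin
      sign q * X 1 (suc q) * det m (minorMatrix X 1 (suc q))
        ≈⟨ *-cong (*-congˡ (Xᵣ q)) (det-cong m _ _ (AgreeOffRow₀-minor₁ X Y q X≈Y)) ⟩
      sign q * (α * Y 1 (suc q) + Z 1 (suc q)) * det m (minorMatrix Y 1 (suc q))
        ≈⟨ solve 5 (λ s a y z d → s :* (a :* y :+ z) :* d := a :* (s :* y :* d) :+ s :* z :* d) refl _ _ _ _ _ ⟩
      α * laplaceTerm m Y (suc q) + sign q * Z 1 (suc q) * det m (minorMatrix Y 1 (suc q))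
        ≈⟨ +-congˡ (*-congˡ (det-cong m _ _ (AgreeOffRow₀-minor₁ Y Z q (λ a b a≢0 →
             trans (sym (X≈Y a b a≢0)) (X≈Z a b a≢0))))) ⟩
      α * laplaceTerm m Y (suc q) + laplaceTerm m Z (suc q) ∎
  det-rowLinear (suc m) X Y Z (suc r) α (s≤s r<m) X≈Y X≈Z Xᵣ = det-linear-termwise m X Y Z α termwise
    where
    termwise : ∀ q → laplaceTerm m X (suc q) ≈ α * laplaceTerm m Y (suc q) + laplaceTerm m Z (suc q)
    termwise q = begin
      sign q * X 1 (suc q) * det m (minorMatrix X 1 (suc q))
        ≈⟨ *-congˡ (det-rowLinear m _ _ _ r α r<m (AgreeOffRow-minor₁ X Y q X≈Y) (AgreeOffRow-minor₁ X Z q X≈Z)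
             (λ b → begin
               minorMatrix X 1 (suc q) (suc r) (suc b)      ≡⟨ minor₁ X q r b ⟩
               X (suc (suc r)) (suc (punchIn q b))          ≈⟨ Xᵣ (punchIn q b) ⟩
               α * Y (suc (suc r)) (suc (punchIn q b)) + Z (suc (suc r)) (suc (punchIn q b))
                 ≡⟨ ≡.cong₂ (λ y z → α * y + z) (minor₁ Y q r b) (minor₁ Z q r b) ⟨
               α * minorMatrix Y 1 (suc q) (suc r) (suc b) + minorMatrix Z 1 (suc q) (suc r) (suc b) ∎)) ⟩
      sign q * X 1 (suc q) * (α * det m (minorMatrix Y 1 (suc q)) + det m (minorMatrix Z 1 (suc q)))
        ≈⟨ solve 5 (λ s x a y z → s :* x :* (a :* y :+ z) := a :* (s :* x :* y) :+ s :* x :* z) refl _ _ _ _ _ ⟩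
      α * (sign q * X 1 (suc q) * det m (minorMatrix Y 1 (suc q))) + sign q * X 1 (suc q) * det m (minorMatrix Z 1 (suc q))
        ≈⟨ +-cong (*-congˡ (*-congʳ (*-congˡ (X≈Y 0 q (λ ()))))) (*-congʳ (*-congˡ (X≈Z 0 q (λ ())))) ⟩
      α * laplaceTerm m Y (suc q) + laplaceTerm m Z (suc q) ∎

  det-zeroRow : ∀ m (X : Matrix) r → r < m → (∀ b → X (suc r) (suc b) ≈ 0#) → det m X ≈ 0#
  det-zeroRow m X r r<m Xᵣ≈0 = x+x≈x⇒x≈0 (det m X) (begin
    det m X + det m X          ≈⟨ +-congʳ (*-identityˡ _) ⟨
    1# * det m X + det m X     ≈⟨ det-rowLinear m X X X r 1# r<m (λ _ _ _ → refl) (λ _ _ _ → refl) Xᵣ ⟨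
    det m X                    ∎)
    where
    Xᵣ : ∀ b → X (suc r) (suc b) ≈ 1# * X (suc r) (suc b) + X (suc r) (suc b)
    Xᵣ b = trans (Xᵣ≈0 b) (sym (trans (+-cong (trans (*-identityˡ _) (Xᵣ≈0 b)) (Xᵣ≈0 b)) (+-identityʳ 0#)))

  transpose : Matrix → Matrix
  transpose M a b = M b a

  -- Expand both sides along the first row and then the first column: the two double sums agree termwise.
  det-transpose : ∀ m (X : Matrix) → det m (transpose X) ≈ det m X
  det-transpose zero X = refl
  det-transpose (suc zero) X = refl
  det-transpose (suc (suc m)) X = begin
    det (suc (suc m)) (transpose X)
      ≈⟨ Σ-head (suc m) _ ⟩
    corner (transpose X) + Σ[1… suc m ] (λ q → sign q * X (suc q) 1 * det (suc m) (transpose (minorMatrix X (suc q) 1)))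
      ≈⟨ +-congˡ (Σ-cong (suc m) (λ q _ → *-congˡ (det-transpose (suc m) (minorMatrix X (suc (suc q)) 1)))) ⟩
    corner (transpose X) + Σ[1… suc m ] (λ q → sign q * X (suc q) 1 * det (suc m) (minorMatrix X (suc q) 1))
      ≈⟨ +-congˡ (Σ-cong (suc m) (λ q _ → *-Σ (suc m) _ _)) ⟩
    corner (transpose X) + Σ[1… suc m ] (λ q → Σ[1… suc m ] (columnThenRow q))
      ≈⟨ +-congˡ (Σ-comm (suc m) (suc m) _) ⟩
    corner (transpose X) + Σ[1… suc m ] (λ r → Σ[1… suc m ] (λ q → columnThenRow q r))
      ≈⟨ +-congˡ (Σ-cong (suc m) (λ r _ → Σ-cong (suc m) (λ q _ → columnThenRow≈rowThenColumn r q))) ⟩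
    corner (transpose X) + Σ[1… suc m ] (λ r → Σ[1… suc m ] (rowThenColumn r))
      ≈⟨ +-congˡ (Σ-cong (suc m) (λ r _ → *-Σ (suc m) _ _)) ⟨
    corner (transpose X) + Σ[1… suc m ] (λ r → sign r * X 1 (suc r) * det (suc m) (transpose (minorMatrix X 1 (suc r))))
      ≈⟨ +-cong (*-congˡ (det-transpose (suc m) (minorMatrix X 1 1)))
                (Σ-cong (suc m) (λ r _ → *-congˡ (det-transpose (suc m) (minorMatrix X 1 (suc (suc r)))))) ⟩
    corner X + Σ[1… suc m ] (λ r → sign r * X 1 (suc r) * det (suc m) (minorMatrix X 1 (suc r)))
      ≈⟨ Σ-head (suc m) _ ⟨
    det (suc (suc m)) X ∎
    where
    corner : Matrix → Carrier
    corner M = laplaceTerm (suc m) M 1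
    columnThenRow : ℕ → ℕ → Carrier
    columnThenRow q r = sign q * X (suc q) 1 * laplaceTerm m (minorMatrix X (suc q) 1) r
    rowThenColumn : ℕ → ℕ → Carrier
    rowThenColumn r q = sign r * X 1 (suc r) * laplaceTerm m (transpose (minorMatrix X 1 (suc r))) q
    columnThenRow≈rowThenColumn : ∀ r q → columnThenRow (suc q) (suc r) ≈ rowThenColumn (suc r) (suc q)
    columnThenRow≈rowThenColumn r q = begin
      - sign q * x * (sign r * y * det m (minorMatrix (minorMatrix X (suc (suc q)) 1) 1 (suc r)))
        ≈⟨ *-congˡ (*-congˡ (det-cong m _ _ (λ a b _ _ → reflexive (≡.cong₂ X (punchIn² q a) (≡.sym (punchIn² r b)))))) ⟩
      - sign q * x * (sign r * y * D)
        ≈⟨ *-congˡ (*-congˡ (det-transpose m _)) ⟨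
      - sign q * x * (sign r * y * Dᵀ)
        ≈⟨ -‿pullˡ _ _ _ ⟩
      - (sign q * x * (sign r * y * Dᵀ))
        ≈⟨ -‿cong (solve 5 (λ sq x sr y d → sq :* x :* (sr :* y :* d) := sr :* y :* (sq :* x :* d)) refl _ _ _ _ _) ⟩
      - (sign r * y * (sign q * x * Dᵀ))
        ≈⟨ -‿pullˡ _ _ _ ⟨
      - sign r * y * (sign q * x * Dᵀ) ∎
      where
      x = X (suc (suc q)) 1
      y = X 1 (suc (suc r))
      D = det m (minorMatrix (minorMatrix X 1 (suc (suc r))) (suc q) 1)
      Dᵀ = det m (transpose (minorMatrix (minorMatrix X 1 (suc (suc r))) (suc q) 1))
      punchIn² : ∀ q a → punchIn (suc (suc q)) (suc (suc a)) ≡ punchIn 1 (punchIn (suc q) (suc a))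
      punchIn² q a = ≡.trans (≡.trans (punchIn-suc (suc q) (suc a)) (≡.cong suc (punchIn-suc q a)))
                             (≡.sym (≡.cong (punchIn 1) (punchIn-suc q a)))

  swapAdjacentColumns : ℕ → Matrix → Matrix
  swapAdjacentColumns c X a b = X a (swapAdjacent c b)

  Σ-extract₂ : ∀ m (f : ℕ → Carrier) c → 1 ≤ c → suc c ≤ suc (suc m) →
    Σ[1… suc (suc m) ] f ≈ (Σ[1… m ] (λ q → f (punchIn (suc c) (punchIn c q))) + f c) + f (suc c)
  Σ-extract₂ m f c 1≤c c<2+m = trans (Σ-extract (suc m) f (suc c) (s≤s z≤n) c<2+m)
    (+-congʳ (trans (Σ-extract m (λ q → f (punchIn (suc c) q)) c 1≤c (ℕₚ.≤-pred c<2+m))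
                    (+-congˡ (reflexive (≡.cong f (punchIn-< (ℕₚ.n<1+n c)))))))

  -- In the expansion along the first row, the terms for the columns c, c+1 and those for the remaining
  -- columns are treated separately; a remaining column q leaves c, c+1 adjacent in the minor, so
  -- induction applies there.
  module AdjacentColumns (m : ℕ) (X : Matrix) (c : ℕ) (1≤c : 1 ≤ c) (c<2+m : suc c ≤ suc (suc m)) where
    otherColumn : ℕ → ℕ
    otherColumn q = punchIn (suc c) (punchIn c q)

    otherColumn-bounds : ∀ q → q < m → 1 ≤ otherColumn (suc q) × otherColumn (suc q) ≤ suc (suc m)
    otherColumn-bounds q q<m =
      ℕₚ.≤-trans (s≤s z≤n) (ℕₚ.≤-trans (≤-punchIn c (suc q)) (≤-punchIn (suc c) (punchIn c (suc q)))) ,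
      ℕₚ.≤-trans (punchIn-≤suc (suc c) _) (s≤s (ℕₚ.≤-trans (punchIn-≤suc c (suc q)) (s≤s q<m)))

    preimage : ∀ q → q < m → AdjacentPreimage (otherColumn (suc q)) c (suc m)
    preimage q q<m = adjacentPreimage (proj₁ (otherColumn-bounds q q<m)) (proj₂ (otherColumn-bounds q q<m))
                       1≤c c<2+m (punchIn²≢ c (suc q)) (punchInᵢ≢i (suc c) (punchIn c (suc q)))

    det-split : ∀ (Y : Matrix) → det (suc (suc m)) Y ≈
      (Σ[1… m ] (λ q → laplaceTerm (suc m) Y (otherColumn q)) + laplaceTerm (suc m) Y c)
      + laplaceTerm (suc m) Y (suc c)
    det-split Y = Σ-extract₂ m (laplaceTerm (suc m) Y) c 1≤c c<2+m

  det-equalAdjacentColumns : ∀ m (X : Matrix) c → 1 ≤ c → suc c ≤ m → (∀ a → X a c ≈ X a (suc c)) → det m X ≈ 0#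
  det-equalAdjacentColumns (suc zero) X (suc c) _ (s≤s ())
  det-equalAdjacentColumns (suc (suc m)) X (suc c₀) 1≤c c<2+m Xc≈Xc+1 = begin
    det (suc (suc m)) X
      ≈⟨ det-split X ⟩
    (Σ[1… m ] (λ q → term (otherColumn q)) + term c) + term (suc c)
      ≈⟨ +-assoc _ _ _ ⟩
    Σ[1… m ] (λ q → term (otherColumn q)) + (term c + term (suc c))
      ≈⟨ +-cong (Σ-zero m _ (otherTerm≈0 (det-equalAdjacentColumns (suc m)))) cancelling ⟩
    0# + 0#
      ≈⟨ +-identityˡ _ ⟩
    0# ∎
    where
    c = suc c₀
    open AdjacentColumns m X c 1≤c c<2+m
    term = laplaceTerm (suc m) X
    otherTerm≈0 : (∀ (Y : Matrix) c → 1 ≤ c → suc c ≤ suc m → (∀ a → Y a c ≈ Y a (suc c)) → det (suc m) Y ≈ 0#) →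
                  ∀ q → q < m → term (otherColumn (suc q)) ≈ 0#
    otherTerm≈0 ih q q<m = trans (*-congˡ (ih (minorMatrix X 1 (otherColumn (suc q)))
        c' 1≤c' c'<m (λ a → trans (reflexive (≡.cong (X (punchIn 1 a)) image))
                             (trans (Xc≈Xc+1 (punchIn 1 a)) (reflexive (≡.cong (X (punchIn 1 a)) (≡.sym image-suc)))))))
      (zeroʳ _)
      where open AdjacentPreimage (preimage q q<m)
    minors-equal : det (suc m) (minorMatrix X 1 c) ≈ det (suc m) (minorMatrix X 1 (suc c))
    minors-equal = det-cong (suc m) (minorMatrix X 1 c) (minorMatrix X 1 (suc c)) (λ a b _ _ → entry (suc a) (suc b))
      where
      entry : ∀ a b → X (punchIn 1 a) (punchIn c b) ≈ X (punchIn 1 a) (punchIn (suc c) b)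
      entry a b with punchIn-adjacent c b
      ... | inj₁ e = reflexive (≡.cong (X (punchIn 1 a)) e)
      ... | inj₂ (e , e-suc) = trans (reflexive (≡.cong (X (punchIn 1 a)) e))
                                 (trans (sym (Xc≈Xc+1 _)) (reflexive (≡.cong (X (punchIn 1 a)) (≡.sym e-suc))))
    cancelling : term c + term (suc c) ≈ 0#
    cancelling = begin
      term c + term (suc c)
        ≈⟨ +-congˡ (-‿pullˡ _ _ _) ⟩
      term c + - (sign c₀ * X 1 (suc c) * det (suc m) (minorMatrix X 1 (suc c)))
        ≈⟨ +-congˡ (-‿cong (*-cong (*-congˡ (Xc≈Xc+1 1)) minors-equal)) ⟨
      term c + - term c
        ≈⟨ -‿inverseʳ _ ⟩
      0# ∎

  det-swapAdjacentColumns : ∀ m (X : Matrix) c → 1 ≤ c → suc c ≤ m →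
                            det m (swapAdjacentColumns c X) ≈ - det m X
  det-swapAdjacentColumns (suc zero) X (suc c) _ (s≤s ())
  det-swapAdjacentColumns (suc (suc m)) X (suc c₀) 1≤c c<2+m = begin
    det (suc (suc m)) X'
      ≈⟨ det-split X' ⟩
    (Σ[1… m ] (λ q → term' (otherColumn q)) + term' c) + term' (suc c)
      ≈⟨ +-cong (+-cong (trans (Σ-cong m (otherTerm (det-swapAdjacentColumns (suc m)))) (sym (-‿Σ m _)))
                        term'-c)
                term'-suc ⟩
    (- Σ[1… m ] (λ q → term (otherColumn q)) + - term (suc c)) + - term c
      ≈⟨ solve 3 (λ s u v → (s :+ u) :+ v := (s :+ v) :+ u) refl _ _ _ ⟩
    (- Σ[1… m ] (λ q → term (otherColumn q)) + - term c) + - term (suc c)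
      ≈⟨ +-cong (-‿+-comm _ _) refl ⟩
    - (Σ[1… m ] (λ q → term (otherColumn q)) + term c) + - term (suc c)
      ≈⟨ -‿+-comm _ _ ⟩
    - ((Σ[1… m ] (λ q → term (otherColumn q)) + term c) + term (suc c))
      ≈⟨ -‿cong (det-split X) ⟨
    - det (suc (suc m)) X ∎
    where
    c = suc c₀
    X' = swapAdjacentColumns c X
    open AdjacentColumns m X c 1≤c c<2+m
    term = laplaceTerm (suc m) X
    term' = laplaceTerm (suc m) X'
    otherTerm : (∀ (Y : Matrix) c → 1 ≤ c → suc c ≤ suc m → det (suc m) (swapAdjacentColumns c Y) ≈ - det (suc m) Y) →
                ∀ q → q < m → term' (otherColumn (suc q)) ≈ - term (otherColumn (suc q))
    otherTerm ih q q<m = begin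
      sign (q' ∸ 1) * X 1 (swapAdjacent c q') * det (suc m) (minorMatrix X' 1 q')
        ≈⟨ *-cong (*-congˡ (reflexive (≡.cong (X 1) (swapAdjacent-other c q' (punchIn²≢ c (suc q))
                                                      (punchInᵢ≢i (suc c) (punchIn c (suc q)))))))
                  (det-cong (suc m) (minorMatrix X' 1 q') (swapAdjacentColumns c' (minorMatrix X 1 q')) (λ a b _ _ →
                    reflexive (≡.cong (X (punchIn 1 (suc a))) (swapAdjacent-punchIn q' image image-suc (suc b))))) ⟩
      sign (q' ∸ 1) * X 1 q' * det (suc m) (swapAdjacentColumns c' (minorMatrix X 1 q'))
        ≈⟨ *-congˡ (ih (minorMatrix X 1 q') c' 1≤c' c'<m) ⟩
      sign (q' ∸ 1) * X 1 q' * - det (suc m) (minorMatrix X 1 q')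
        ≈⟨ -‿distribʳ-* _ _ ⟨
      - term q' ∎
      where
      q' = otherColumn (suc q)
      open AdjacentPreimage (preimage q q<m)
    term'-c : term' c ≈ - term (suc c)
    term'-c = begin
      sign c₀ * X 1 (swapAdjacent c c) * det (suc m) (minorMatrix X' 1 c)
        ≈⟨ *-cong (*-congˡ (reflexive (≡.cong (X 1) (swapAdjacent-c c))))
                  (det-cong (suc m) (minorMatrix X' 1 c) (minorMatrix X 1 (suc c)) (λ a b _ _ →
                    reflexive (≡.cong (X (punchIn 1 (suc a))) (swapAdjacent-punchIn-c c (suc b))))) ⟩
      sign c₀ * X 1 (suc c) * det (suc m) (minorMatrix X 1 (suc c))
        ≈⟨ -‿involutive _ ⟨
      - (- (sign c₀ * X 1 (suc c) * det (suc m) (minorMatrix X 1 (suc c))))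
        ≈⟨ -‿cong (-‿pullˡ _ _ _) ⟨
      - term (suc c) ∎
    term'-suc : term' (suc c) ≈ - term c
    term'-suc = begin
      - sign c₀ * X 1 (swapAdjacent c (suc c)) * det (suc m) (minorMatrix X' 1 (suc c))
        ≈⟨ *-cong (*-congˡ (reflexive (≡.cong (X 1) (swapAdjacent-suc c))))
                  (det-cong (suc m) (minorMatrix X' 1 (suc c)) (minorMatrix X 1 c) (λ a b _ _ →
                    reflexive (≡.cong (X (punchIn 1 (suc a))) (swapAdjacent-punchIn-suc c (suc b))))) ⟩
      - sign c₀ * X 1 c * det (suc m) (minorMatrix X 1 c)
        ≈⟨ -‿pullˡ _ _ _ ⟩
      - term c ∎

  -- Move column c next to its copy by adjacent swaps.
  det-equalColumns-gap : ∀ k m (X : Matrix) c → 1 ≤ c → suc (k ℕ.+ c) ≤ m →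
                         (∀ a → X a c ≈ X a (suc (k ℕ.+ c))) → det m X ≈ 0#
  det-equalColumns-gap zero m X c 1≤c c<m Xc≈Xd = det-equalAdjacentColumns m X c 1≤c c<m Xc≈Xd
  det-equalColumns-gap (suc k) m X c 1≤c d≤m Xc≈Xd = begin
    det m X                                ≈⟨ -‿involutive _ ⟨
    - (- det m X)                          ≈⟨ -‿cong (det-swapAdjacentColumns m X c 1≤c c<m) ⟨
    - det m (swapAdjacentColumns c X)      ≈⟨ -‿cong (det-equalColumns-gap k m _ (suc c) (s≤s z≤n) d≤m' swapped) ⟩
    - 0#                                   ≈⟨ -0#≈0# ⟩
    0#                                     ∎
    where
    k+1+c≡1+k+c : k ℕ.+ suc c ≡ suc (k ℕ.+ c)
    k+1+c≡1+k+c = ℕₚ.+-suc k c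
    c<m : suc c ≤ m
    c<m = ℕₚ.≤-trans (s≤s (ℕₚ.m≤n+m c (suc k))) d≤m
    d≤m' : suc (k ℕ.+ suc c) ≤ m
    d≤m' = ≡.subst (λ i → suc i ≤ m) (≡.sym k+1+c≡1+k+c) d≤m
    d≢c : suc (suc (k ℕ.+ c)) ≢ c
    d≢c e = ℕₚ.<-irrefl (≡.sym e) (ℕₚ.<-trans (s≤s (ℕₚ.m≤n+m c k)) (ℕₚ.n<1+n _))
    d≢1+c : suc (suc (k ℕ.+ c)) ≢ suc c
    d≢1+c e = ℕₚ.<-irrefl (≡.sym e) (s≤s (s≤s (ℕₚ.m≤n+m c k)))
    swapped : ∀ a → swapAdjacentColumns c X a (suc c) ≈ swapAdjacentColumns c X a (suc (k ℕ.+ suc c))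
    swapped a = begin
      X a (swapAdjacent c (suc c))              ≡⟨ ≡.cong (X a) (swapAdjacent-suc c) ⟩
      X a c                                     ≈⟨ Xc≈Xd a ⟩
      X a (suc (suc (k ℕ.+ c)))                 ≡⟨ ≡.cong (X a) (swapAdjacent-other c _ d≢c d≢1+c) ⟨
      X a (swapAdjacent c (suc (suc (k ℕ.+ c)))) ≡⟨ ≡.cong (λ i → X a (swapAdjacent c (suc i))) k+1+c≡1+k+c ⟨
      X a (swapAdjacent c (suc (k ℕ.+ suc c)))  ∎

  det-equalColumns-< : ∀ m (X : Matrix) c d → 1 ≤ c → c < d → d ≤ m → (∀ a → X a c ≈ X a d) → det m X ≈ 0#
  det-equalColumns-< m X c d 1≤c c<d d≤m Xc≈Xd =
    det-equalColumns-gap (d ∸ suc c) m X c 1≤c (≡.subst (_≤ m) d≡ d≤m) (λ a → trans (Xc≈Xd a) (reflexive (≡.cong (X a) d≡)))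
    where
    d≡ : d ≡ suc ((d ∸ suc c) ℕ.+ c)
    d≡ = ≡.trans (≡.sym (ℕₚ.m+[n∸m]≡n c<d)) (≡.cong suc (ℕₚ.+-comm c (d ∸ suc c)))

  det-equalColumns : ∀ m (X : Matrix) c d → 1 ≤ c → 1 ≤ d → c ≤ m → d ≤ m → c ≢ d →
                     (∀ a → X a c ≈ X a d) → det m X ≈ 0#
  det-equalColumns m X c d 1≤c 1≤d c≤m d≤m c≢d Xc≈Xd with ℕₚ.<-cmp c d
  ... | tri< c<d _ _ = det-equalColumns-< m X c d 1≤c c<d d≤m Xc≈Xd
  ... | tri≈ _ c≡d _ = ⊥-elim (c≢d c≡d)
  ... | tri> _ _ d<c = det-equalColumns-< m X d c 1≤d d<c c≤m (λ a → sym (Xc≈Xd a))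

  det-equalRows : ∀ m (X : Matrix) r s → 1 ≤ r → 1 ≤ s → r ≤ m → s ≤ m → r ≢ s →
                  (∀ b → X r b ≈ X s b) → det m X ≈ 0#
  det-equalRows m X r s 1≤r 1≤s r≤m s≤m r≢s Xr≈Xs =
    trans (sym (det-transpose m X)) (det-equalColumns m (transpose X) r s 1≤r 1≤s r≤m s≤m r≢s Xr≈Xs)

  -- Cofactors and linearity in a row

  setRow : Matrix → ℕ → (ℕ → Carrier) → Matrix
  setRow M r x a b = if a ≡ᵇ r then x b else M a b

  setColumn : Matrix → ℕ → (ℕ → Carrier) → Matrix
  setColumn M c y a b = if b ≡ᵇ c then y a else M a b

  basis : ℕ → ℕ → Carrier
  basis c b = if b ≡ᵇ c then 1# else 0#

  setRow-≡ : ∀ M r x b → setRow M r x r b ≡ x b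
  setRow-≡ M r x b rewrite ≡ᵇ-refl r = ≡.refl

  setRow-≢ : ∀ M r x a b → a ≢ r → setRow M r x a b ≡ M a b
  setRow-≢ M r x a b a≢r rewrite ≡ᵇ-false a≢r = ≡.refl

  setColumn-≢ : ∀ M c y a b → b ≢ c → setColumn M c y a b ≡ M a b
  setColumn-≢ M c y a b b≢c rewrite ≡ᵇ-false b≢c = ≡.refl

  basis-≡ : ∀ c → basis c c ≡ 1#
  basis-≡ c rewrite ≡ᵇ-refl c = ≡.refl

  basis-≢ : ∀ c b → b ≢ c → basis c b ≡ 0#
  basis-≢ c b b≢c rewrite ≡ᵇ-false b≢c = ≡.refl

  basis-punchIn : ∀ q {c c'} → punchIn q c' ≡ c → ∀ b → basis c (punchIn q b) ≡ basis c' b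
  basis-punchIn q {c} {c'} e b with b ≟ c'
  ... | yes ≡.refl rewrite e | basis-≡ c | basis-≡ b = ≡.refl
  ... | no b≢c' rewrite basis-≢ c' b b≢c' =
    basis-≢ c (punchIn q b) (λ e' → b≢c' (punchIn-injective q (≡.trans e' (≡.sym e))))

  -- The cofactor of the entry (r, c): expanding along the first row, only the terms avoiding column c
  -- survive, and each of them is a cofactor of a smaller matrix.
  det-setRow-basis : ∀ m (X : Matrix) r c → 1 ≤ r → r ≤ suc m → 1 ≤ c → c ≤ suc m →
    det (suc m) (setRow X r (basis c)) ≈ sign (r ℕ.+ c) * det m (minorMatrix X r c)
  det-setRow-basis m X (suc zero) (suc c₀) _ _ 1≤c c≤1+m = begin
    det (suc m) (setRow X 1 (basis c))
      ≈⟨ Σ-single (suc m) _ c 1≤c c≤1+m (λ q _ _ q≢c →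
           trans (*-congʳ (trans (*-congˡ (reflexive (basis-≢ c q q≢c))) (zeroʳ _))) (zeroˡ _)) ⟩
    sign c₀ * basis c c * det m (minorMatrix (setRow X 1 (basis c)) 1 c)
      ≈⟨ *-cong (trans (*-congˡ (reflexive (basis-≡ c))) (*-identityʳ _)) (det-cong m _ _ (λ _ _ _ _ → refl)) ⟩
    sign c₀ * det m (minorMatrix X 1 c)
      ≈⟨ *-congʳ (sign-+2 c₀) ⟨
    sign (suc c) * det m (minorMatrix X 1 c) ∎
    where c = suc c₀
  det-setRow-basis zero X (suc (suc r₀)) _ _ (s≤s ()) _ _
  det-setRow-basis (suc m) X (suc (suc r₀)) (suc c₀) _ r≤2+m 1≤c c≤2+m = begin
    det (suc (suc m)) Y
      ≈⟨ Σ-extract (suc m) (laplaceTerm (suc m) Y) c 1≤c c≤2+m ⟩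
    Σ[1… suc m ] (λ q → laplaceTerm (suc m) Y (punchIn c q)) + laplaceTerm (suc m) Y c
      ≈⟨ +-cong (Σ-cong (suc m) otherTerm) term-c≈0 ⟩
    Σ[1… suc m ] (λ q → sign (r ℕ.+ c) * laplaceTerm m (minorMatrix X r c) q) + 0#
      ≈⟨ +-identityʳ _ ⟩
    Σ[1… suc m ] (λ q → sign (r ℕ.+ c) * laplaceTerm m (minorMatrix X r c) q)
      ≈⟨ *-Σ (suc m) _ _ ⟨
    sign (r ℕ.+ c) * det (suc m) (minorMatrix X r c) ∎
    where
    r = suc (suc r₀)
    c = suc c₀
    Y = setRow X r (basis c)
    term-c≈0 : laplaceTerm (suc m) Y c ≈ 0#
    term-c≈0 = trans (*-congˡ (det-zeroRow (suc m) (minorMatrix Y 1 c) r₀ (s≤s (ℕₚ.≤-pred (ℕₚ.≤-pred r≤2+m))) zeroRow))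
                     (zeroʳ _)
      where
      zeroRow : ∀ b → minorMatrix Y 1 c (suc r₀) (suc b) ≈ 0#
      zeroRow b = reflexive (≡.trans (≡.cong (λ i → if i then basis c b′ else X r b′) (≡ᵇ-refl r₀))
                                     (basis-≢ c b′ (punchInᵢ≢i c (suc b))))
        where b′ = punchIn c (suc b)
    minorY : ∀ q c' → punchIn q c' ≡ c →
             AgreeOn (suc m) (minorMatrix Y 1 q) (setRow (minorMatrix X 1 q) (suc r₀) (basis c'))
    minorY q c' e a b _ _ with a ≡ᵇ r₀
    ... | true = reflexive (basis-punchIn q e (suc b))
    ... | false = refl
    viaMinor : ∀ q' c' → punchIn q' c' ≡ c → 1 ≤ c' → c' ≤ suc m →
      laplaceTerm (suc m) Y q' ≈
        sign (q' ∸ 1) * X 1 q' * (sign (suc r₀ ℕ.+ c') * det m (minorMatrix (minorMatrix X 1 q') (suc r₀) c'))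
    viaMinor q' c' e 1≤c' c'≤1+m = *-congˡ (trans
      (det-cong (suc m) (minorMatrix Y 1 q') (setRow (minorMatrix X 1 q') (suc r₀) (basis c')) (minorY q' c' e))
      (det-setRow-basis m (minorMatrix X 1 q') (suc r₀) c' (s≤s z≤n) (ℕₚ.≤-pred r≤2+m) 1≤c' c'≤1+m))
    otherTerm : ∀ q → q < suc m →
                laplaceTerm (suc m) Y (punchIn c (suc q)) ≈ sign (r ℕ.+ c) * laplaceTerm m (minorMatrix X r c) (suc q)
    otherTerm q q<1+m with suc q <? c
    ... | yes (s≤s q<c₀) = begin
      laplaceTerm (suc m) Y (punchIn c (suc q))
        ≡⟨ ≡.cong (laplaceTerm (suc m) Y) e ⟩
      laplaceTerm (suc m) Y (suc q)
        ≈⟨ viaMinor (suc q) c₀ (punchIn-≥ q<c₀) (ℕₚ.≤-trans (s≤s z≤n) q<c₀) (ℕₚ.≤-pred c≤2+m) ⟩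
      sign q * X 1 (suc q) * (sign (suc r₀ ℕ.+ c₀) * det m (minorMatrix (minorMatrix X 1 (suc q)) (suc r₀) c₀))
        ≈⟨ *-congˡ (*-cong sign-shift (det-cong m (minorMatrix (minorMatrix X 1 (suc q)) (suc r₀) c₀)
                                                 (minorMatrix (minorMatrix X r c) 1 (suc q)) (λ a b _ _ →
             reflexive (≡.cong₂ X (≡.sym (punchIn-punchIn {1} {suc r₀} (suc a) (s≤s z≤n)))
                                  (≡.sym (punchIn-punchIn {suc q} {c₀} (suc b) q<c₀)))))) ⟩
      sign q * X 1 (suc q) * (sign (r ℕ.+ c) * det m (minorMatrix (minorMatrix X r c) 1 (suc q)))
        ≈⟨ solve 4 (λ s x t d → s :* x :* (t :* d) := t :* (s :* x :* d)) refl _ _ _ _ ⟩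
      sign (r ℕ.+ c) * (sign q * X 1 (suc q) * det m (minorMatrix (minorMatrix X r c) 1 (suc q)))
        ≡⟨ ≡.cong (λ i → sign (r ℕ.+ c) * (sign q * X 1 i * det m (minorMatrix (minorMatrix X r c) 1 (suc q)))) e ⟨
      sign (r ℕ.+ c) * laplaceTerm m (minorMatrix X r c) (suc q) ∎
      where
      e = punchIn-< {c} {suc q} (s≤s q<c₀)
      sign-shift : sign (suc r₀ ℕ.+ c₀) ≈ sign (r ℕ.+ c)
      sign-shift = sym (trans (sign-+2 (r₀ ℕ.+ c)) (reflexive (≡.cong sign (ℕₚ.+-suc r₀ c₀))))
    ... | no q≮c = begin
      laplaceTerm (suc m) Y (punchIn c (suc q))
        ≡⟨ ≡.cong (laplaceTerm (suc m) Y) e ⟩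
      laplaceTerm (suc m) Y (suc (suc q))
        ≈⟨ viaMinor (suc (suc q)) c (punchIn-< (s≤s (ℕₚ.≮⇒≥ q≮c))) 1≤c (ℕₚ.≤-trans (ℕₚ.≮⇒≥ q≮c) q<1+m) ⟩
      - sign q * X 1 (suc (suc q)) * (sign (suc r₀ ℕ.+ c) * det m (minorMatrix (minorMatrix X 1 (suc (suc q))) (suc r₀) c))
        ≈⟨ *-congˡ (*-congˡ (det-cong m (minorMatrix (minorMatrix X 1 (suc (suc q))) (suc r₀) c)
                                        (minorMatrix (minorMatrix X r c) 1 (suc q)) (λ a b _ _ →
             reflexive (≡.cong₂ X (≡.sym (punchIn-punchIn {1} {suc r₀} (suc a) (s≤s z≤n)))
                                  (punchIn-punchIn {c} {suc q} (suc b) (ℕₚ.≮⇒≥ q≮c)))))) ⟩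
      - sign q * X 1 (suc (suc q)) * (sign (suc r₀ ℕ.+ c) * det m (minorMatrix (minorMatrix X r c) 1 (suc q)))
        ≈⟨ -‿pullˡ _ _ _ ⟩
      - (sign q * X 1 (suc (suc q)) * (sign (suc r₀ ℕ.+ c) * det m (minorMatrix (minorMatrix X r c) 1 (suc q))))
        ≈⟨ -‿cong (solve 4 (λ s x t d → s :* x :* (t :* d) := t :* (s :* x :* d)) refl _ _ _ _) ⟩
      - (sign (suc r₀ ℕ.+ c) * (sign q * X 1 (suc (suc q)) * det m (minorMatrix (minorMatrix X r c) 1 (suc q))))
        ≈⟨ -‿distribˡ-* _ _ ⟩
      sign (r ℕ.+ c) * (sign q * X 1 (suc (suc q)) * det m (minorMatrix (minorMatrix X r c) 1 (suc q)))
        ≡⟨ ≡.cong (λ i → sign (r ℕ.+ c) * (sign q * X 1 i * det m (minorMatrix (minorMatrix X r c) 1 (suc q)))) e ⟨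
      sign (r ℕ.+ c) * laplaceTerm m (minorMatrix X r c) (suc q) ∎
      where
      e = punchIn-≥ {c} {suc q} (ℕₚ.≮⇒≥ q≮c)

  AgreeOffRow-setRow : ∀ M r₀ x y → AgreeOffRow r₀ (setRow M (suc r₀) x) (setRow M (suc r₀) y)
  AgreeOffRow-setRow M r₀ x y a b a≢r₀ = reflexive (≡.trans (setRow-≢ M (suc r₀) x (suc a) (suc b) 1+a≢1+r₀)
                                                              (≡.sym (setRow-≢ M (suc r₀) y (suc a) (suc b) 1+a≢1+r₀)))
    where 1+a≢1+r₀ = λ e → a≢r₀ (ℕₚ.suc-injective e)

  det-setRow-cong : ∀ m M r x y → (∀ b → x b ≈ y b) → det m (setRow M r x) ≈ det m (setRow M r y)
  det-setRow-cong m M r x y x≈y = det-cong m _ _ entries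
    where
    entries : AgreeOn m (setRow M r x) (setRow M r y)
    entries a b _ _ with suc a ≡ᵇ r
    ... | true = x≈y (suc b)
    ... | false = refl

  det-setRow-+ : ∀ m M r → 1 ≤ r → r ≤ m → ∀ α x y →
    det m (setRow M r (λ b → α * x b + y b)) ≈ α * det m (setRow M r x) + det m (setRow M r y)
  det-setRow-+ m M (suc r₀) (s≤s _) r≤m α x y =
    det-rowLinear m _ _ _ r₀ α r≤m (AgreeOffRow-setRow M r₀ αx+y x) (AgreeOffRow-setRow M r₀ αx+y y) (λ b →
      reflexive (≡.trans (setRow-≡ M (suc r₀) αx+y (suc b))
                         (≡.sym (≡.cong₂ (λ u v → α * u + v) (setRow-≡ M (suc r₀) x (suc b)) (setRow-≡ M (suc r₀) y (suc b))))))
    where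
    αx+y : ℕ → Carrier
    αx+y b = α * x b + y b

  det-setRow-* : ∀ m M r → 1 ≤ r → r ≤ m → ∀ α x → det m (setRow M r (λ b → α * x b)) ≈ α * det m (setRow M r x)
  det-setRow-* m M (suc r₀) 1≤r r≤m α x = begin
    det m (setRow M r (λ b → α * x b))                    ≈⟨ det-setRow-cong m M r _ _ (λ b → sym (+-identityʳ _)) ⟩
    det m (setRow M r (λ b → α * x b + 0#))               ≈⟨ det-setRow-+ m M r 1≤r r≤m α x (λ _ → 0#) ⟩
    α * det m (setRow M r x) + det m (setRow M r (λ _ → 0#))
      ≈⟨ +-congˡ (det-zeroRow m _ r₀ r≤m (λ b → reflexive (setRow-≡ M r (λ _ → 0#) (suc b)))) ⟩
    α * det m (setRow M r x) + 0#                         ≈⟨ +-identityʳ _ ⟩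
    α * det m (setRow M r x)                              ∎
    where r = suc r₀

  det-setRow-linear : ∀ m M r → 1 ≤ r → r ≤ m → ∀ α x β y →
    det m (setRow M r (λ b → α * x b + β * y b)) ≈ α * det m (setRow M r x) + β * det m (setRow M r y)
  det-setRow-linear m M r 1≤r r≤m α x β y =
    trans (det-setRow-+ m M r 1≤r r≤m α x _) (+-congˡ (det-setRow-* m M r 1≤r r≤m β y))

  det-setRow-Σ : ∀ m M r → 1 ≤ r → r ≤ m → ∀ K (z : ℕ → Carrier) (v : ℕ → ℕ → Carrier) →
    det m (setRow M r (λ b → Σ[1… K ] (λ k → z k * v k b))) ≈ Σ[1… K ] (λ k → z k * det m (setRow M r (v k)))
  det-setRow-Σ m M (suc r₀) _ r≤m zero z v =
    det-zeroRow m _ r₀ r≤m (λ b → reflexive (setRow-≡ M (suc r₀) (λ _ → 0#) (suc b)))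
  det-setRow-Σ m M r 1≤r r≤m (suc K) z v = begin
    det m (setRow M r (λ b → Σ[1… K ] (λ k → z k * v k b) + z (suc K) * v (suc K) b))
      ≈⟨ det-setRow-cong m M r _ _ (λ b → +-congʳ (sym (*-identityˡ _))) ⟩
    det m (setRow M r (λ b → 1# * Σ[1… K ] (λ k → z k * v k b) + z (suc K) * v (suc K) b))
      ≈⟨ det-setRow-linear m M r 1≤r r≤m 1# _ (z (suc K)) (v (suc K)) ⟩
    1# * det m (setRow M r (λ b → Σ[1… K ] (λ k → z k * v k b))) + z (suc K) * det m (setRow M r (v (suc K)))
      ≈⟨ +-congʳ (trans (*-identityˡ _) (det-setRow-Σ m M r 1≤r r≤m K z v)) ⟩
    Σ[1… suc K ] (λ k → z k * det m (setRow M r (v k))) ∎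

  det-setRow-expand : ∀ m M r → 1 ≤ r → r ≤ m → ∀ x →
    det m (setRow M r x) ≈ Σ[1… m ] (λ c → x c * det m (setRow M r (basis c)))
  det-setRow-expand m M r 1≤r r≤m x = begin
    det m (setRow M r x)
      ≈⟨ det-cong m _ _ entries ⟩
    det m (setRow M r (λ b → Σ[1… m ] (λ c → x c * basis c b)))
      ≈⟨ det-setRow-Σ m M r 1≤r r≤m m x basis ⟩
    Σ[1… m ] (λ c → x c * det m (setRow M r (basis c))) ∎
    where
    coordinates : ∀ b → 1 ≤ b → b ≤ m → x b ≈ Σ[1… m ] (λ c → x c * basis c b)
    coordinates b 1≤b b≤m = sym (trans
      (Σ-single m _ b 1≤b b≤m (λ c _ _ c≢b → trans (*-congˡ (reflexive (basis-≢ c b (≡.≢-sym c≢b)))) (zeroʳ _)))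
      (trans (*-congˡ (reflexive (basis-≡ b))) (*-identityʳ _)))
    entries : AgreeOn m (setRow M r x) (setRow M r (λ b → Σ[1… m ] (λ c → x c * basis c b)))
    entries a b _ b<m with suc a ≡ᵇ r
    ... | true = coordinates (suc b) (s≤s z≤n) b<m
    ... | false = refl

  det-addColumnCombination : ∀ m M q → 1 ≤ q → q ≤ m → ∀ (z : ℕ → Carrier) →
    det m (setColumn M q (λ a → Σ[1… m ] (λ c → z c * M a c))) ≈ z q * det m M
  det-addColumnCombination m M q 1≤q q≤m z = begin
    det m (setColumn M q (λ a → Σ[1… m ] (λ c → z c * M a c)))
      ≈⟨ det-transpose m (setRow (transpose M) q _) ⟩
    det m (setRow (transpose M) q (λ a → Σ[1… m ] (λ c → z c * M a c)))
      ≈⟨ det-setRow-Σ m (transpose M) q 1≤q q≤m m z (λ c a → M a c) ⟩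
    Σ[1… m ] (λ c → z c * det m (setRow (transpose M) q (λ a → M a c)))
      ≈⟨ Σ-single m _ q 1≤q q≤m (λ c 1≤c c≤m c≢q → trans (*-congˡ (repeatedColumn c 1≤c c≤m c≢q)) (zeroʳ _)) ⟩
    z q * det m (setRow (transpose M) q (λ a → M a q))
      ≈⟨ *-congˡ (trans (det-transpose m _) (det-cong m _ _ unchanged)) ⟩
    z q * det m M ∎
    where
    repeatedColumn : ∀ c → 1 ≤ c → c ≤ m → c ≢ q → det m (setRow (transpose M) q (λ a → M a c)) ≈ 0#
    repeatedColumn c 1≤c c≤m c≢q = det-equalRows m _ q c 1≤q 1≤c q≤m c≤m (≡.≢-sym c≢q) (λ a →
      reflexive (≡.trans (setRow-≡ (transpose M) q (λ a → M a c) a)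
                         (≡.sym (setRow-≢ (transpose M) q (λ a → M a c) c a c≢q))))
    unchanged : AgreeOn m (setColumn M q (λ a → M a q)) M
    unchanged a b _ _ with suc b ≟ q
    ... | yes ≡.refl = reflexive (≡.cong (λ i → if i then M (suc a) (suc b) else M (suc a) (suc b)) (≡ᵇ-refl (suc b)))
    ... | no b≢q = reflexive (setColumn-≢ M q (λ a → M a q) (suc a) (suc b) b≢q)

  setRows : Matrix → ℕ → ℕ → (ℕ → Carrier) → (ℕ → Carrier) → Matrix
  setRows M r s x y = setRow (setRow M r x) s y

  setRows-first : ∀ M {r s} x y b → r ≢ s → setRows M r s x y r b ≡ x b
  setRows-first M {r} {s} x y b r≢s = ≡.trans (setRow-≢ (setRow M r x) s y r b r≢s) (setRow-≡ M r x b)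

  setRows-other : ∀ M {r s} x y {a} b → a ≢ r → a ≢ s → setRows M r s x y a b ≡ M a b
  setRows-other M {r} {s} x y b a≢r a≢s = ≡.trans (setRow-≢ (setRow M r x) s y _ b a≢s) (setRow-≢ M r x _ b a≢r)

  setRows-comm : ∀ M {r s} x y a b → r ≢ s → setRows M r s x y a b ≡ setRows M s r y x a b
  setRows-comm M {r} {s} x y a b r≢s with a ≟ r | a ≟ s
  ... | yes ≡.refl | yes a≡s = ⊥-elim (r≢s a≡s)
  ... | yes ≡.refl | no _ = ≡.trans (setRows-first M x y b r≢s) (≡.sym (setRow-≡ (setRow M s y) a x b))
  ... | no _ | yes ≡.refl = ≡.trans (setRow-≡ (setRow M r x) a y b) (≡.sym (setRows-first M y x b (≡.≢-sym r≢s)))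
  ... | no a≢r | no a≢s = ≡.trans (setRows-other M x y b a≢r a≢s) (≡.sym (setRows-other M y x b a≢s a≢r))

  setRows-keepFirst : ∀ M r s y a b → setRows M r s (M r) y a b ≡ setRow M s y a b
  setRows-keepFirst M r s y a b with a ≡ᵇ s
  ... | true = ≡.refl
  ... | false with a ≟ r
  ...   | yes ≡.refl = setRow-≡ M a (M a) b
  ...   | no a≢r = setRow-≢ M r (M r) a b a≢r

  setRows-keepSecond : ∀ M r s x a b → s ≢ r → setRows M r s x (M s) a b ≡ setRow M r x a b
  setRows-keepSecond M r s x a b s≢r with a ≟ s
  ... | yes ≡.refl = ≡.trans (setRow-≡ (setRow M r x) a (M a) b) (≡.sym (setRow-≢ M r x a b s≢r))
  ... | no a≢s = setRow-≢ (setRow M r x) s (M s) a b a≢s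

  module TwoRows (m : ℕ) (M : Matrix) {r s : ℕ}
    (1≤r : 1 ≤ r) (r≤m : r ≤ m) (1≤s : 1 ≤ s) (s≤m : s ≤ m) (r≢s : r ≢ s) where
    form : (ℕ → Carrier) → (ℕ → Carrier) → Carrier
    form x y = det m (setRows M r s x y)

    form-linearʳ : ∀ x α y β y' → form x (λ b → α * y b + β * y' b) ≈ α * form x y + β * form x y'
    form-linearʳ x = det-setRow-linear m (setRow M r x) s 1≤s s≤m

    form-comm : ∀ x y → form x y ≈ det m (setRows M s r y x)
    form-comm x y = det-cong m _ _ (λ a b _ _ → reflexive (setRows-comm M x y (suc a) (suc b) r≢s))

    form-linearˡ : ∀ α x β x' y → form (λ b → α * x b + β * x' b) y ≈ α * form x y + β * form x' y
    form-linearˡ α x β x' y = begin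
      form (λ b → α * x b + β * x' b) y
        ≈⟨ form-comm _ y ⟩
      det m (setRows M s r y (λ b → α * x b + β * x' b))
        ≈⟨ det-setRow-linear m (setRow M s y) r 1≤r r≤m α x β x' ⟩
      α * det m (setRows M s r y x) + β * det m (setRows M s r y x')
        ≈⟨ +-cong (*-congˡ (form-comm x y)) (*-congˡ (form-comm x' y)) ⟨
      α * form x y + β * form x' y ∎

    form-diagonal : ∀ x → form x x ≈ 0#
    form-diagonal x = det-equalRows m _ r s 1≤r 1≤s r≤m s≤m r≢s (λ b →
      reflexive (≡.trans (setRows-first M x x b r≢s) (≡.sym (setRow-≡ (setRow M r x) s x b))))

    form-antisym : ∀ x y → form x y ≈ - form y x
    form-antisym x y = +-inverseˡ-unique _ _ (begin
      form x y + form y x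
        ≈⟨ +-cong (+-identityˡ _) (+-identityʳ _) ⟨
      (0# + form x y) + (form y x + 0#)
        ≈⟨ +-cong (+-congʳ (form-diagonal x)) (+-congˡ (form-diagonal y)) ⟨
      (form x x + form x y) + (form y x + form y y)
        ≈⟨ +-cong (lin (form-linearʳ x 1# x 1# y)) (lin (form-linearʳ y 1# x 1# y)) ⟨
      form x x+y + form y x+y
        ≈⟨ lin (form-linearˡ 1# x 1# y x+y) ⟨
      form x+y x+y
        ≈⟨ form-diagonal x+y ⟩
      0# ∎)
      where
      x+y : ℕ → Carrier
      x+y b = 1# * x b + 1# * y b
      lin : ∀ {t u v} → t ≈ 1# * u + 1# * v → t ≈ u + v
      lin t≈ = trans t≈ (+-cong (*-identityˡ _) (*-identityˡ _))

  -- The Desnanot–Jacobi identity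

  minor-setRow-basis : ∀ m (M : Matrix) {r r' c c'} → r < r' → c < c' →
    AgreeOn m (minorMatrix (setRow M r (basis c)) r' c') (setRow (minorMatrix M r' c') r (basis c))
  minor-setRow-basis m M {r} {r'} {c} {c'} r<r' c<c' a b _ _ with suc a ≟ r
  ... | yes ≡.refl = begin
    setRow M (suc a) (basis c) (punchIn r' (suc a)) (punchIn c' (suc b))
      ≡⟨ ≡.cong (λ i → setRow M (suc a) (basis c) i (punchIn c' (suc b))) (punchIn-< r<r') ⟩
    setRow M (suc a) (basis c) (suc a) (punchIn c' (suc b))
      ≡⟨ setRow-≡ M (suc a) (basis c) _ ⟩
    basis c (punchIn c' (suc b))
      ≡⟨ basis-punchIn c' (punchIn-< c<c') (suc b) ⟩
    basis c (suc b)
      ≡⟨ setRow-≡ (minorMatrix M r' c') (suc a) (basis c) (suc b) ⟨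
    setRow (minorMatrix M r' c') (suc a) (basis c) (suc a) (suc b) ∎
  ... | no 1+a≢r = reflexive (≡.trans
    (setRow-≢ M r (basis c) _ _ (λ e → 1+a≢r (punchIn-injective r' (≡.trans e (≡.sym (punchIn-< r<r'))))))
    (≡.sym (setRow-≢ (minorMatrix M r' c') r (basis c) (suc a) (suc b) 1+a≢r)))

  det-setRows-basis : ∀ m (M : Matrix) {p p' q q'} →
    1 ≤ p → p < p' → p' ≤ suc (suc m) → 1 ≤ q → q < q' → q' ≤ suc (suc m) →
    det (suc (suc m)) (setRows M p p' (basis q) (basis q')) ≈
      sign (p' ℕ.+ q') * (sign (p ℕ.+ q) * det m (minorMatrix (minorMatrix M p' q') p q))
  det-setRows-basis m M {p} {p'} {q} {q'} 1≤p p<p' p'≤ 1≤q q<q' q'≤ = begin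
    det (suc (suc m)) (setRows M p p' (basis q) (basis q'))
      ≈⟨ det-setRow-basis (suc m) (setRow M p (basis q)) p' q' (ℕₚ.≤-trans 1≤p (ℕₚ.<⇒≤ p<p')) p'≤
                                                               (ℕₚ.≤-trans 1≤q (ℕₚ.<⇒≤ q<q')) q'≤ ⟩
    sign (p' ℕ.+ q') * det (suc m) (minorMatrix (setRow M p (basis q)) p' q')
      ≈⟨ *-congˡ (det-cong (suc m) (minorMatrix (setRow M p (basis q)) p' q') (setRow (minorMatrix M p' q') p (basis q))
                           (minor-setRow-basis (suc m) M p<p' q<q')) ⟩
    sign (p' ℕ.+ q') * det (suc m) (setRow (minorMatrix M p' q') p (basis q))
      ≈⟨ *-congˡ (det-setRow-basis m (minorMatrix M p' q') p q 1≤p (ℕₚ.≤-pred (ℕₚ.<-≤-trans p<p' p'≤))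
                                                               1≤q (ℕₚ.≤-pred (ℕₚ.<-≤-trans q<q' q'≤))) ⟩
    sign (p' ℕ.+ q') * (sign (p ℕ.+ q) * det m (minorMatrix (minorMatrix M p' q') p q)) ∎

  -- With H(x, y) the determinant of M with rows p, p' replaced by x, y, replacing column q by
  -- Σ_c H(e_c, e_q') M_{·c} and then column q' by Σ_c H(e_q, e_c) M_{·c} multiplies the determinant by
  -- H(e_q, e_q') twice (once per column operation). By Cramer's rule the new columns are combinations of
  -- e_p and e_p' whose coefficients are cofactors, so the new determinant is a 2×2 determinant of
  -- cofactors times H(e_q, e_q') again. Cancelling H(e_q, e_q') = ±K leaves the identity.
  module DesnanotJacobi (m : ℕ) (M : Matrix) {p p' q q' : ℕ}
    (1≤p : 1 ≤ p) (p<p' : p < p') (p'≤n : p' ≤ suc (suc m))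
    (1≤q : 1 ≤ q) (q<q' : q < q') (q'≤n : q' ≤ suc (suc m)) where

    n : ℕ
    n = suc (suc m)

    p≤n = ℕₚ.≤-trans (ℕₚ.<⇒≤ p<p') p'≤n
    q≤n = ℕₚ.≤-trans (ℕₚ.<⇒≤ q<q') q'≤n
    1≤p' = ℕₚ.≤-trans 1≤p (ℕₚ.<⇒≤ p<p')
    1≤q' = ℕₚ.≤-trans 1≤q (ℕₚ.<⇒≤ q<q')
    p≢p' = ℕₚ.<⇒≢ p<p'
    q≢q' = ℕₚ.<⇒≢ q<q'

    open TwoRows n M 1≤p p≤n 1≤p' p'≤n p≢p' renaming (form to H)
    open TwoRows n (transpose M) 1≤q q≤n 1≤q' q'≤n q≢q' using () renaming
      ( form to Hᵀ; form-linearˡ to Hᵀ-linearˡ; form-linearʳ to Hᵀ-linearʳ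
      ; form-diagonal to Hᵀ-diagonal; form-antisym to Hᵀ-antisym)

    K h G : Carrier
    K = det m (minorMatrix (minorMatrix M p' q') p q)
    h = H (basis q) (basis q')
    G = Hᵀ (basis p) (basis p')

    cofactor : ℕ → ℕ → Carrier
    cofactor r c = det n (setRow M r (basis c))

    combination : Carrier → Carrier → ℕ → Carrier
    combination α β a = α * basis p a + β * basis p' a

    combination-p : ∀ α β → combination α β p ≈ α
    combination-p α β = begin
      α * basis p p + β * basis p' p   ≡⟨ ≡.cong₂ (λ u v → α * u + β * v) (basis-≡ p) (basis-≢ p' p p≢p') ⟩
      α * 1# + β * 0#                  ≈⟨ +-cong (*-identityʳ α) (zeroʳ β) ⟩
      α + 0#                           ≈⟨ +-identityʳ α ⟩
      α                                ∎

    combination-p' : ∀ α β → combination α β p' ≈ β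
    combination-p' α β = begin
      α * basis p p' + β * basis p' p'  ≡⟨ ≡.cong₂ (λ u v → α * u + β * v) (basis-≢ p p' (≡.≢-sym p≢p')) (basis-≡ p') ⟩
      α * 0# + β * 1#                   ≈⟨ +-cong (zeroʳ α) (*-identityʳ β) ⟩
      0# + β                            ≈⟨ +-identityˡ β ⟩
      β                                 ∎

    combination-other : ∀ α β a → a ≢ p → a ≢ p' → combination α β a ≈ 0#
    combination-other α β a a≢p a≢p' = begin
      α * basis p a + β * basis p' a  ≡⟨ ≡.cong₂ (λ u v → α * u + β * v) (basis-≢ p a a≢p) (basis-≢ p' a a≢p') ⟩
      α * 0# + β * 0#                 ≈⟨ +-cong (zeroʳ α) (zeroʳ β) ⟩
      0# + 0#                         ≈⟨ +-identityʳ 0# ⟩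
      0#                              ∎

    H-keepFirst : ∀ y → H (M p) y ≈ det n (setRow M p' y)
    H-keepFirst y = det-cong n (setRows M p p' (M p) y) (setRow M p' y) (λ a b _ _ →
      reflexive (setRows-keepFirst M p p' y (suc a) (suc b)))

    H-keepSecond : ∀ x → H x (M p') ≈ det n (setRow M p x)
    H-keepSecond x = det-cong n (setRows M p p' x (M p')) (setRow M p x) (λ a b _ _ →
      reflexive (setRows-keepSecond M p p' x (suc a) (suc b) (≡.≢-sym p≢p')))

    -- Cramer's rule for the rows of M.
    H-rowˡ : ∀ a → 1 ≤ a → a ≤ n → ∀ y → H (M a) y ≈ combination (det n (setRow M p' y)) (- det n (setRow M p y)) a
    H-rowˡ a 1≤a a≤n y with a ≟ p | a ≟ p'
    ... | yes ≡.refl | yes a≡p' = ⊥-elim (p≢p' a≡p')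
    ... | yes ≡.refl | no _ = trans (H-keepFirst y) (sym (combination-p _ _))
    ... | no _ | yes ≡.refl = trans (form-antisym (M a) y) (trans (-‿cong (H-keepSecond y)) (sym (combination-p' _ _)))
    ... | no a≢p | no a≢p' = trans
      (det-equalRows n (setRows M p p' (M a) y) p a 1≤p 1≤a p≤n a≤n (≡.≢-sym a≢p) (λ b →
        reflexive (≡.trans (setRows-first M (M a) y b p≢p') (≡.sym (setRows-other M (M a) y b a≢p a≢p')))))
      (sym (combination-other _ _ a a≢p a≢p'))

    H-rowʳ : ∀ a → 1 ≤ a → a ≤ n → ∀ x → H x (M a) ≈ combination (- det n (setRow M p' x)) (det n (setRow M p x)) a
    H-rowʳ a 1≤a a≤n x with a ≟ p | a ≟ p'
    ... | yes ≡.refl | yes a≡p' = ⊥-elim (p≢p' a≡p')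
    ... | yes ≡.refl | no _ = trans (form-antisym x (M a)) (trans (-‿cong (H-keepFirst x)) (sym (combination-p _ _)))
    ... | no _ | yes ≡.refl = trans (H-keepSecond x) (sym (combination-p' _ _))
    ... | no a≢p | no a≢p' = trans
      (det-equalRows n (setRows M p p' x (M a)) p' a 1≤p' 1≤a p'≤n a≤n (≡.≢-sym a≢p') (λ b →
        reflexive (≡.trans (setRow-≡ (setRow M p x) p' (M a) b) (≡.sym (setRows-other M x (M a) b a≢p a≢p')))))
      (sym (combination-other _ _ a a≢p a≢p'))

    z w : ℕ → Carrier
    z c = H (basis c) (basis q')
    w c = H (basis q) (basis c)

    N₁ N₂ : Matrix
    N₁ = setColumn M q (λ a → Σ[1… n ] (λ c → z c * M a c))
    N₂ = setColumn N₁ q' (λ a → Σ[1… n ] (λ c → w c * N₁ a c))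

    det-N₂ : det n N₂ ≈ h * (h * det n M)
    det-N₂ = trans (det-addColumnCombination n N₁ q' 1≤q' q'≤n w)
                   (*-congˡ (det-addColumnCombination n M q 1≤q q≤n z))

    Σz-expand : ∀ a → Σ[1… n ] (λ c → z c * M a c) ≈ H (M a) (basis q')
    Σz-expand a = begin
      Σ[1… n ] (λ c → z c * M a c)
        ≈⟨ Σ-cong n (λ c _ → trans (*-comm _ _) (*-congˡ (form-comm (basis (suc c)) (basis q')))) ⟩
      Σ[1… n ] (λ c → M a c * det n (setRows M p' p (basis q') (basis c)))
        ≈⟨ det-setRow-expand n (setRow M p' (basis q')) p 1≤p p≤n (M a) ⟨
      det n (setRows M p' p (basis q') (M a))
        ≈⟨ form-comm (M a) (basis q') ⟨
      H (M a) (basis q') ∎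

    Σw-expand : ∀ a → Σ[1… n ] (λ c → w c * N₁ a c) ≈ H (basis q) (M a)
    Σw-expand a = begin
      Σ[1… n ] (λ c → w c * N₁ a c)
        ≈⟨ Σ-cong n N₁→M ⟩
      Σ[1… n ] (λ c → w c * M a c)
        ≈⟨ Σ-cong n (λ c _ → *-comm _ _) ⟩
      Σ[1… n ] (λ c → M a c * w c)
        ≈⟨ det-setRow-expand n (setRow M p (basis q)) p' 1≤p' p'≤n (M a) ⟨
      H (basis q) (M a) ∎
      where
      -- N₁ differs from M only in column q, where the coefficient w q vanishes.
      N₁→M : ∀ c → c < n → w (suc c) * N₁ a (suc c) ≈ w (suc c) * M a (suc c)
      N₁→M c _ with suc c ≟ q
      ... | yes ≡.refl = trans (trans (*-congʳ (form-diagonal (basis q))) (zeroˡ _))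
                               (sym (trans (*-congʳ (form-diagonal (basis q))) (zeroˡ _)))
      ... | no c≢q = *-congˡ (reflexive (setColumn-≢ M q (λ a → Σ[1… n ] (λ c → z c * M a c)) a (suc c) c≢q))

    A B C D : Carrier
    A = cofactor p' q'
    B = - cofactor p q'
    C = - cofactor p' q
    D = cofactor p q

    N₂-columns : AgreeOn n N₂ (setColumn (setColumn M q (combination A B)) q' (combination C D))
    N₂-columns a b a<n b<n with suc b ≡ᵇ q'
    ... | true = trans (Σw-expand (suc a)) (H-rowʳ (suc a) (s≤s z≤n) a<n (basis q))
    ... | false with suc b ≡ᵇ q
    ...   | true = trans (Σz-expand (suc a)) (H-rowˡ (suc a) (s≤s z≤n) a<n (basis q'))
    ...   | false = refl

    det-N₂-columns : det n N₂ ≈ (A * D - B * C) * G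
    det-N₂-columns = begin
      det n N₂
        ≈⟨ det-cong n N₂ (setColumn (setColumn M q (combination A B)) q' (combination C D)) N₂-columns ⟩
      det n (setColumn (setColumn M q (combination A B)) q' (combination C D))
        ≈⟨ det-transpose n (setRows (transpose M) q q' (combination A B) (combination C D)) ⟩
      Hᵀ (combination A B) (combination C D)
        ≈⟨ Hᵀ-linearˡ A (basis p) B (basis p') _ ⟩
      A * Hᵀ (basis p) (combination C D) + B * Hᵀ (basis p') (combination C D)
        ≈⟨ +-cong (*-congˡ (Hᵀ-linearʳ (basis p) C (basis p) D (basis p')))
                  (*-congˡ (Hᵀ-linearʳ (basis p') C (basis p) D (basis p'))) ⟩
      A * (C * Hᵀ (basis p) (basis p) + D * G) + B * (C * Hᵀ (basis p') (basis p) + D * Hᵀ (basis p') (basis p'))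
        ≈⟨ +-cong (*-congˡ (+-congʳ (*-congˡ (Hᵀ-diagonal (basis p)))))
                  (*-congˡ (+-cong (*-congˡ (Hᵀ-antisym (basis p') (basis p))) (*-congˡ (Hᵀ-diagonal (basis p'))))) ⟩
      A * (C * 0# + D * G) + B * (C * - G + D * 0#)
        ≈⟨ +-cong (*-congˡ (trans (+-congʳ (zeroʳ C)) (+-identityˡ _))) (*-congˡ (trans (+-congˡ (zeroʳ D)) (+-identityʳ _))) ⟩
      A * (D * G) + B * (C * - G)
        ≈⟨ +-congˡ (trans (*-congˡ (sym (-‿distribʳ-* C G))) (sym (-‿distribʳ-* B (C * G)))) ⟩
      A * (D * G) + - (B * (C * G))
        ≈⟨ +-cong (sym (*-assoc A D G)) (-‿cong (sym (*-assoc B C G))) ⟩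
      A * D * G + - (B * C * G)
        ≈⟨ +-congˡ (-‿distribˡ-* (B * C) G) ⟩
      A * D * G + - (B * C) * G
        ≈⟨ distribʳ G _ _ ⟨
      (A * D - B * C) * G ∎

    S : Carrier
    S = sign (p' ℕ.+ q') * sign (p ℕ.+ q)

    S*S≈1 : S * S ≈ 1#
    S*S≈1 = begin
      S * S
        ≈⟨ solve 2 (λ a b → (a :* b) :* (a :* b) := (a :* a) :* (b :* b)) refl _ _ ⟩
      sign (p' ℕ.+ q') * sign (p' ℕ.+ q') * (sign (p ℕ.+ q) * sign (p ℕ.+ q))
        ≈⟨ *-cong (sign-squared (p' ℕ.+ q')) (sign-squared (p ℕ.+ q)) ⟩
      1# * 1#
        ≈⟨ *-identityˡ 1# ⟩
      1# ∎

    h≈SK : h ≈ S * K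
    h≈SK = trans (det-setRows-basis m M 1≤p p<p' p'≤n 1≤q q<q' q'≤n) (sym (*-assoc _ _ _))

    G≈h : G ≈ h
    G≈h = begin
      G                                                         ≈⟨ det-setRows-basis m (transpose M) 1≤q q<q' q'≤n 1≤p p<p' p'≤n ⟩
      sign (q' ℕ.+ p') * (sign (q ℕ.+ p) * det m (transpose (minorMatrix (minorMatrix M p' q') p q)))
        ≈⟨ *-cong (reflexive (≡.cong sign (ℕₚ.+-comm q' p'))) (*-cong (reflexive (≡.cong sign (ℕₚ.+-comm q p))) (det-transpose m _)) ⟩
      sign (p' ℕ.+ q') * (sign (p ℕ.+ q) * K)                    ≈⟨ *-assoc _ _ _ ⟨
      S * K                                                     ≈⟨ h≈SK ⟨
      h                                                         ∎

    h≉0 : ¬ (K ≈ 0#) → ¬ (h ≈ 0#)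
    h≉0 K≉0 h≈0 = K≉0 (*-cancelˡ-selfInverse S*S≈1 (begin
      S * K    ≈⟨ h≈SK ⟨
      h        ≈⟨ h≈0 ⟩
      0#       ≈⟨ zeroʳ S ⟨
      S * 0#   ∎))

    cofactors : ¬ (K ≈ 0#) → A * D - B * C ≈ h * det n M
    cofactors K≉0 = *-cancelʳ-nonzero (h≉0 K≉0) (begin
      (A * D - B * C) * h     ≈⟨ *-congˡ G≈h ⟨
      (A * D - B * C) * G     ≈⟨ det-N₂-columns ⟨
      det n N₂                ≈⟨ det-N₂ ⟩
      h * (h * det n M)       ≈⟨ solve 2 (λ a d → a :* (a :* d) := (a :* d) :* a) refl _ _ ⟩
      h * det n M * h         ∎)

  det-desnanotJacobi : ∀ m (M : Matrix) {p p' q q'} →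
    1 ≤ p → p < p' → p' ≤ suc (suc m) → 1 ≤ q → q < q' → q' ≤ suc (suc m) →
    ¬ (det m (minorMatrix (minorMatrix M p' q') p q) ≈ 0#) →
    det (suc (suc m)) M * det m (minorMatrix (minorMatrix M p' q') p q) ≈
      det (suc m) (minorMatrix M p q) * det (suc m) (minorMatrix M p' q')
      - det (suc m) (minorMatrix M p q') * det (suc m) (minorMatrix M p' q)
  det-desnanotJacobi m M {p} {p'} {q} {q'} 1≤p p<p' p'≤n 1≤q q<q' q'≤n K≉0 =
    sym (*-cancelˡ-selfInverse S*S≈1 (begin
      S * (a₁ * a₂ + - (b₁ * b₂))
        ≈⟨ distribˡ S _ _ ⟩
      S * (a₁ * a₂) + S * - (b₁ * b₂)
        ≈⟨ +-cong (solve 4 (λ x y u v → (x :* y) :* (u :* v) := (x :* v) :* (y :* u)) refl _ _ _ _)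
                  (trans (sym (-‿distribʳ-* _ _)) (-‿cong (trans (*-congʳ (sym crossSign))
                    (solve 4 (λ x y u v → (x :* y) :* (u :* v) := (x :* u) :* (y :* v)) refl _ _ _ _)))) ⟩
      sign (p' ℕ.+ q') * a₂ * (sign (p ℕ.+ q) * a₁) + - (sign (p ℕ.+ q') * b₁ * (sign (p' ℕ.+ q) * b₂))
        ≈⟨ +-cong (*-cong (cofactor≈minor 1≤p' p'≤n 1≤q' q'≤n) (cofactor≈minor 1≤p p≤n 1≤q q≤n))
                  (-‿cong (*-cong (cofactor≈minor 1≤p p≤n 1≤q' q'≤n) (cofactor≈minor 1≤p' p'≤n 1≤q q≤n))) ⟨
      A * D + - (cofactor p q' * cofactor p' q)
        ≈⟨ +-congˡ (-‿cong (-‿cancel _ _)) ⟨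
      A * D - B * C
        ≈⟨ cofactors K≉0 ⟩
      h * det n M
        ≈⟨ *-congʳ h≈SK ⟩
      S * K * det n M
        ≈⟨ solve 3 (λ s k d → s :* k :* d := s :* (d :* k)) refl _ _ _ ⟩
      S * (det n M * K) ∎))
    where
    open DesnanotJacobi m M 1≤p p<p' p'≤n 1≤q q<q' q'≤n
    a₁ = det (suc m) (minorMatrix M p q)
    a₂ = det (suc m) (minorMatrix M p' q')
    b₁ = det (suc m) (minorMatrix M p q')
    b₂ = det (suc m) (minorMatrix M p' q)
    cofactor≈minor : ∀ {r c} → 1 ≤ r → r ≤ n → 1 ≤ c → c ≤ n → cofactor r c ≈ sign (r ℕ.+ c) * det (suc m) (minorMatrix M r c)
    cofactor≈minor = det-setRow-basis (suc m) M _ _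
    crossSign : sign (p ℕ.+ q') * sign (p' ℕ.+ q) ≈ S
    crossSign = begin
      sign (p ℕ.+ q') * sign (p' ℕ.+ q)     ≈⟨ sign-+ (p ℕ.+ q') (p' ℕ.+ q) ⟨
      sign ((p ℕ.+ q') ℕ.+ (p' ℕ.+ q))      ≡⟨ ≡.cong sign (exponents p p' q q') ⟩
      sign ((p' ℕ.+ q') ℕ.+ (p ℕ.+ q))      ≈⟨ sign-+ (p' ℕ.+ q') (p ℕ.+ q) ⟩
      S                                     ∎
      where
      exponents : ∀ p p' q q' → (p ℕ.+ q') ℕ.+ (p' ℕ.+ q) ≡ (p' ℕ.+ q') ℕ.+ (p ℕ.+ q)
      exponents = solve-∀

module Condensation {a ℓ : Level} (F : Field a ℓ) where
  open Field F hiding (zero)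
  open MatrixDefs F
  open Determinants F
  open SetoidReasoning setoid

  det-condensation : ∀ t (X : Matrix) → ¬ (det (suc t) (sub X 2 2) ≈ 0#) →
    det (suc (suc (suc t))) X * det (suc t) (sub X 2 2) ≈ cond (λ i j → det (suc (suc t)) (sub X i j)) 1 1
  det-condensation t X interior≉0 = begin
    det L X * det (suc t) (sub X 2 2)
      ≈⟨ *-congˡ interior ⟩
    det L X * det (suc t) (minorMatrix (minorMatrix X L L) 1 1)
      ≈⟨ det-desnanotJacobi (suc t) X (s≤s z≤n) (s≤s (s≤s z≤n)) ℕₚ.≤-refl (s≤s z≤n) (s≤s (s≤s z≤n)) ℕₚ.≤-refl
           (λ K≈0 → interior≉0 (trans interior K≈0)) ⟩
    det L′ (minorMatrix X 1 1) * det L′ (minorMatrix X L L) - det L′ (minorMatrix X 1 L) * det L′ (minorMatrix X L 1)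
      ≈⟨ +-cong (trans (*-comm _ _) (*-cong topLeft bottomRight)) (-‿cong (*-cong bottomLeft topRight)) ⟩
    cond (λ i j → det L′ (sub X i j)) 1 1 ∎
    where
    L L′ : ℕ
    L = suc (suc (suc t))
    L′ = suc (suc t)
    interior : det (suc t) (sub X 2 2) ≈ det (suc t) (minorMatrix (minorMatrix X L L) 1 1)
    interior = det-cong (suc t) (sub X 2 2) (minorMatrix (minorMatrix X L L) 1 1) (λ a b a<1+t b<1+t →
      reflexive (≡.sym (≡.cong₂ X (punchIn-< (s≤s (s≤s a<1+t))) (punchIn-< (s≤s (s≤s b<1+t))))))
    topLeft : det L′ (minorMatrix X L L) ≈ det L′ (sub X 1 1)
    topLeft = det-cong L′ (minorMatrix X L L) (sub X 1 1) (λ a b a<L′ b<L′ →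
      reflexive (≡.cong₂ X (punchIn-< (s≤s a<L′)) (punchIn-< (s≤s b<L′))))
    bottomRight : det L′ (minorMatrix X 1 1) ≈ det L′ (sub X 2 2)
    bottomRight = det-cong L′ (minorMatrix X 1 1) (sub X 2 2) (λ _ _ _ _ → refl)
    bottomLeft : det L′ (minorMatrix X 1 L) ≈ det L′ (sub X 2 1)
    bottomLeft = det-cong L′ (minorMatrix X 1 L) (sub X 2 1) (λ a b _ b<L′ →
      reflexive (≡.cong (X (suc (suc a))) (punchIn-< (s≤s b<L′))))
    topRight : det L′ (minorMatrix X L 1) ≈ det L′ (sub X 1 2)
    topRight = det-cong L′ (minorMatrix X L 1) (sub X 1 2) (λ a b a<L′ _ →
      reflexive (≡.cong (λ i → X i (suc (suc b))) (punchIn-< (s≤s a<L′))))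

  sub-sub : ∀ s (A : Matrix) p q i j →
    AgreeOn s (sub (sub A (suc p) (suc q)) (suc i) (suc j)) (sub A (suc (i ℕ.+ p)) (suc (j ℕ.+ q)))
  sub-sub s A p q i j a b _ _ = reflexive (≡.cong₂ A (reassociate p i (suc a)) (reassociate q j (suc b)))
    where
    reassociate : ∀ p i x → p ℕ.+ (i ℕ.+ x) ≡ (i ℕ.+ p) ℕ.+ x
    reassociate = solve-∀

  dodgson-divisor : ∀ n t → suc (suc t) ≤ n → n ∸ suc (suc (n ∸ suc (suc t))) ≡ t
  dodgson-divisor (suc (suc n)) t (s≤s (s≤s t≤n)) = ℕₚ.m∸[m∸n]≡n t≤n

  2+[n∸[2+t]]≤n : ∀ n t → suc (suc t) ≤ n → suc (suc (n ∸ suc (suc t))) ≤ n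
  2+[n∸[2+t]]≤n (suc (suc n)) t _ = s≤s (s≤s (ℕₚ.m∸n≤m n t))
  2+[n∸[2+t]]≤n (suc zero) t (s≤s ())

  module _ {n k : ℕ} (A : Matrix) (noZeroDivisor : NoZeroDivisorDownTo n A k) where

    divisor≉0 : ∀ t → suc (suc t) ℕ.+ k ≤ n → ∀ p q → suc p ℕ.+ suc (suc t) ≤ n → suc q ℕ.+ suc (suc t) ≤ n →
                ¬ (dodgson A t (suc (suc p)) (suc (suc q)) ≈ 0#)
    divisor≉0 t t+2+k≤n p q p-bound q-bound =
      ≡.subst (λ s → ¬ (dodgson A s (suc (suc p)) (suc (suc q)) ≈ 0#)) (dodgson-divisor n t t+2≤n)
        (noZeroDivisor m (suc p) (suc q) k≤m m+2≤n (s≤s z≤n) (ℕₚ.m+n≤o⇒m≤o∸n (suc p) p-bound)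
                                         (s≤s z≤n) (ℕₚ.m+n≤o⇒m≤o∸n (suc q) q-bound))
      where
      m = n ∸ suc (suc t)
      t+2≤n : suc (suc t) ≤ n
      t+2≤n = ℕₚ.≤-trans (ℕₚ.m≤m+n (suc (suc t)) k) t+2+k≤n
      k≤m : k ≤ m
      k≤m = ℕₚ.m+n≤o⇒m≤o∸n k (≡.subst (_≤ n) (ℕₚ.+-comm (suc (suc t)) k) t+2+k≤n)
      m+2≤n : suc (suc m) ≤ n
      m+2≤n = 2+[n∸[2+t]]≤n n t t+2≤n

    condensationStep : ∀ t → suc (suc t) ℕ.+ k ≤ n →
      (∀ p q → suc p ℕ.+ suc t ≤ n → suc q ℕ.+ suc t ≤ n →
         dodgson A (suc t) (suc p) (suc q) ≈ det (suc (suc t)) (sub A (suc p) (suc q))) →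
      (∀ p q → suc p ℕ.+ t ≤ n → suc q ℕ.+ t ≤ n → dodgson A t (suc p) (suc q) ≈ det (suc t) (sub A (suc p) (suc q))) →
      ∀ p q → suc p ℕ.+ suc (suc t) ≤ n → suc q ℕ.+ suc (suc t) ≤ n →
      dodgson A (suc (suc t)) (suc p) (suc q) ≈ det (suc (suc (suc t))) (sub A (suc p) (suc q))
    condensationStep t t+2+k≤n corners interior p q p-bound q-bound = *≈⇒/≈ divisor (begin
      det (suc (suc (suc t))) X * dodgson A t (suc (suc p)) (suc (suc q))
        ≈⟨ *-congˡ centre ⟩
      det (suc (suc (suc t))) X * det (suc t) (sub X 2 2)
        ≈⟨ det-condensation t X (λ e → divisor (trans centre e)) ⟩
      cond (λ i j → det (suc (suc t)) (sub X i j)) 1 1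
        ≈⟨ +-cong (*-cong (corner 0 0 p-bound′ q-bound′) (corner 1 1 p-bound″ q-bound″))
                  (-‿cong (*-cong (corner 1 0 p-bound″ q-bound′) (corner 0 1 p-bound′ q-bound″))) ⟨
      cond (dodgson A (suc t)) (suc p) (suc q) ∎)
      where
      X = sub A (suc p) (suc q)
      p-bound′ = ℕₚ.≤-trans (ℕₚ.+-monoʳ-≤ (suc p) (ℕₚ.n≤1+n (suc t))) p-bound
      q-bound′ = ℕₚ.≤-trans (ℕₚ.+-monoʳ-≤ (suc q) (ℕₚ.n≤1+n (suc t))) q-bound
      p-bound″ = ≡.subst (_≤ n) (≡.cong suc (ℕₚ.+-suc p (suc t))) p-bound
      q-bound″ = ≡.subst (_≤ n) (≡.cong suc (ℕₚ.+-suc q (suc t))) q-bound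
      divisor : ¬ (dodgson A t (suc (suc p)) (suc (suc q)) ≈ 0#)
      divisor = divisor≉0 t t+2+k≤n p q p-bound q-bound
      corner : ∀ i j → suc (i ℕ.+ p) ℕ.+ suc t ≤ n → suc (j ℕ.+ q) ℕ.+ suc t ≤ n →
               dodgson A (suc t) (suc (i ℕ.+ p)) (suc (j ℕ.+ q)) ≈ det (suc (suc t)) (sub X (suc i) (suc j))
      corner i j i-bound j-bound = trans (corners (i ℕ.+ p) (j ℕ.+ q) i-bound j-bound)
        (sym (det-cong (suc (suc t)) (sub X (suc i) (suc j)) (sub A (suc (i ℕ.+ p)) (suc (j ℕ.+ q)))
                       (sub-sub (suc (suc t)) A p q i j)))
      centre : dodgson A t (suc (suc p)) (suc (suc q)) ≈ det (suc t) (sub X 2 2)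
      centre = trans (interior (suc p) (suc q) (ℕₚ.≤-trans (ℕₚ.+-monoʳ-≤ (suc (suc p)) (ℕₚ.n≤1+n t)) p-bound″)
                                               (ℕₚ.≤-trans (ℕₚ.+-monoʳ-≤ (suc (suc q)) (ℕₚ.n≤1+n t)) q-bound″))
        (sym (det-cong (suc t) (sub X 2 2) (sub A (suc (suc p)) (suc (suc q))) (sub-sub (suc t) A p q 1 1)))

    dodgson≈det : ∀ t → t ℕ.+ k ≤ n → ∀ p q → suc p ℕ.+ t ≤ n → suc q ℕ.+ t ≤ n →
                  dodgson A t (suc p) (suc q) ≈ det (suc t) (sub A (suc p) (suc q))
    dodgson≈det zero _ p q _ _ =
      sym (trans (det-1×1 (sub A (suc p) (suc q))) (reflexive (≡.cong₂ A (ℕₚ.+-comm p 1) (ℕₚ.+-comm q 1))))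
    dodgson≈det (suc zero) _ p q _ _ = sym (trans (det-2×2 (sub A (suc p) (suc q))) (+-cong
      (reflexive (≡.cong₂ _*_ (≡.cong₂ A (ℕₚ.+-comm p 1) (ℕₚ.+-comm q 1)) (≡.cong₂ A (ℕₚ.+-comm p 2) (ℕₚ.+-comm q 2))))
      (-‿cong (trans (*-comm _ _) (reflexive (≡.cong₂ _*_ (≡.cong₂ A (ℕₚ.+-comm p 2) (ℕₚ.+-comm q 1))
                                                         (≡.cong₂ A (ℕₚ.+-comm p 1) (ℕₚ.+-comm q 2))))))))
    dodgson≈det (suc (suc t)) t+2+k≤n =
      condensationStep t t+2+k≤n (dodgson≈det (suc t) (ℕₚ.≤-trans (ℕₚ.n≤1+n _) t+2+k≤n))
                                 (dodgson≈det t (ℕₚ.≤-trans (ℕₚ.m≤n+m _ 2) t+2+k≤n))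

  -- α = A^{(k)}_{i-1,j} as the minor of 𝒜 = A_{i-1…, j-1…} on its rows 1…ℓ+1 and columns 2…ℓ+2.
  det-sub≈doubleMinor : ∀ ℓ′ (A : Matrix) i₀ j₀ →
    det (suc ℓ′) (sub A (suc i₀) (suc (suc j₀))) ≈
      det (suc ℓ′) (minorMatrix (minorMatrix (sub A (suc i₀) (suc j₀)) (suc (suc (suc ℓ′))) (suc (suc (suc ℓ′)))) (suc (suc ℓ′)) 1)
  det-sub≈doubleMinor ℓ′ A i₀ j₀ =
    det-cong (suc ℓ′) (sub A (suc i₀) (suc (suc j₀))) (minorMatrix (minorMatrix 𝒜 L L) (suc (suc ℓ′)) 1) (λ a b a<1+ℓ′ b<1+ℓ′ →
      reflexive (≡.cong₂ A (≡.cong (i₀ ℕ.+_) (≡.sym (row a a<1+ℓ′)))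
                           (≡.trans (≡.sym (ℕₚ.+-suc j₀ (suc b))) (≡.cong (j₀ ℕ.+_) (≡.sym (column b b<1+ℓ′))))))
    where
    L = suc (suc (suc ℓ′))
    𝒜 = sub A (suc i₀) (suc j₀)
    row : ∀ a → a < suc ℓ′ → punchIn L (punchIn (suc (suc ℓ′)) (suc a)) ≡ suc a
    row a a<1+ℓ′ = ≡.trans (≡.cong (punchIn L) (punchIn-< (s≤s a<1+ℓ′))) (punchIn-< (s≤s (ℕₚ.m<n⇒m<1+n a<1+ℓ′)))
    column : ∀ b → b < suc ℓ′ → punchIn L (suc (suc b)) ≡ suc (suc b)
    column b b<1+ℓ′ = punchIn-< (s≤s (s≤s b<1+ℓ′))

theorem2p3 : {c ℓ : Level} (F : Field c ℓ) →
    let open Field F in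
    let open MatrixDefs F in
    (n : ℕ) (A : Matrix) (k : ℕ) → 3 ≤ k → k ≤ n →
    NoZeroDivisorDownTo n A k →
    (i j : ℕ) → 2 ≤ i → i ≤ k ∸ 1 → 2 ≤ j → j ≤ k ∸ 1 →
    level n A k i j ≈ 0# →
    ¬ (level n A k (i ∸ 1) j ≈ 0#) →
    let α = level n A k (i ∸ 1) j in
    let ℓ' = n ∸ k in
    let 𝒜 = sub A (i ∸ 1) (j ∸ 1) in
    let M' = λ p q → det (suc (suc ℓ')) (minorMatrix 𝒜 p q) in
    det2 (M' (suc (suc ℓ')) 1) (M' (suc (suc ℓ')) (suc (suc (suc ℓ'))))
    (M' (suc (suc (suc ℓ'))) 1) (M' (suc (suc (suc ℓ'))) (suc (suc (suc ℓ')))) / α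
    ≈ det (suc (suc (suc ℓ'))) 𝒜
theorem2p3 F n A k _ k≤n noZeroDivisor (suc (suc i₀)) (suc (suc j₀)) (s≤s (s≤s z≤n)) i≤k-1 (s≤s (s≤s z≤n)) j≤k-1 _ α≉0 =
  *≈⇒/≈ α≉0 (begin
    det (suc (suc (suc ℓ′))) 𝒜 * α  ≈⟨ *-congˡ α≈K ⟩
    det (suc (suc (suc ℓ′))) 𝒜 * K  ≈⟨ det-desnanotJacobi (suc ℓ′) 𝒜 (s≤s z≤n) ℕₚ.≤-refl ℕₚ.≤-refl
                                          (s≤s z≤n) (s≤s (s≤s z≤n)) ℕₚ.≤-refl (λ K≈0 → α≉0 (trans α≈K K≈0)) ⟩
    _                               ∎)
  where
  open Field F hiding (zero)
  open MatrixDefs F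
  open Determinants F
  open Condensation F
  open SetoidReasoning setoid
  ℓ′ = n ∸ k
  𝒜 = sub A (suc i₀) (suc j₀)
  α = level n A k (suc i₀) (suc (suc j₀))
  K = det (suc ℓ′) (minorMatrix (minorMatrix 𝒜 (suc (suc (suc ℓ′))) (suc (suc (suc ℓ′)))) (suc (suc ℓ′)) 1)
  fits : ∀ {x} → x ≤ k → x ℕ.+ ℓ′ ≤ n
  fits x≤k = ℕₚ.≤-trans (ℕₚ.+-monoˡ-≤ ℓ′ x≤k) (ℕₚ.≤-reflexive (ℕₚ.m+[n∸m]≡n k≤n))
  α≈K : α ≈ K
  α≈K = trans (dodgson≈det A noZeroDivisor ℓ′ (ℕₚ.≤-reflexive (ℕₚ.m∸n+n≡m k≤n)) i₀ (suc j₀)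
                 (fits (ℕₚ.≤-trans (ℕₚ.n≤1+n _) (ℕₚ.≤-trans i≤k-1 (ℕₚ.m∸n≤m k 1))))
                 (fits (ℕₚ.≤-trans j≤k-1 (ℕₚ.m∸n≤m k 1))))
              (det-sub≈doubleMinor ℓ′ A i₀ j₀)
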